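{- Let $n\ge2$, $s\in\{2,\dots,n\}$, and let $A=W_2W_3\cdots W_s$, where for each $i\in\{2,\dots,s\}$, $W_i=L_n(a^{(i)}_n)L_{n-1}(a^{(i)}_{n-1})\cdots L_i(a^{(i)}_i)$ with all multipliers $a^{(i)}_j>0$ (i.e., $A\in Z_1(s)$). Then \[ r_\ell(A)=\left\lceil \frac{n-1}{s-1}\right\rceil . \]
   Context: For $i\in\{2,\dots,n\}$, $q\in\mathbb{R}$: $L_i(q):=I+qE_{i,i-1}\in\mathbb{R}^{n\times n}$, where $E_{i,i-1}$ has a single nonzero entry $1$ at position $(i,i-1)$. For $M\in\mathbb{R}^{n\times n}$, its lower-left corner minors are $M(\{n-c+1,\dots,n\}|\{1,\dots,c\})$, $c=1,\dots,n$, where $M(\alpha|\beta)$ denotes the determinant of the submatrix with rows $\alpha$ and columns $\beta$. $r_\ell(M)$ is the least positive integer $w$ such that all lower-left corner minors of $M^w$ with $c\in\{1,\dots,n-1\}$ (i.e., except possibly the determinant) are positive. $\lceil y\rceil$ is the smallest integer $\ge y$. -}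

module Defs where

open import Level using (Level; _⊔_) renaming (suc to lsuc)
open import Data.Nat using (ℕ; zero; suc; _∸_; _≤_; _<_; _≟_)
  renaming (_+_ to _+ℕ_)
open import Data.Nat.DivMod using (_/_)
open import Data.Nat.Properties using (m∸n+n≡m; <⇒≤)
open import Data.Fin using (Fin; toℕ; _↑ʳ_; inject≤; cast; punchIn)
  renaming (zero to fzero; suc to fsuc)
open import Data.Product using (∃; _×_)
open import Relation.Nullary using (¬_; yes; no)
open import Relation.Binary using (Rel; IsStrictTotalOrder)
open import Algebra.Bundles using (CommutativeRing)

-- An ordered field (ℝ is the intended model; no reals in agda-stdlib).
record OrderedField (c ℓ₁ ℓ₂ : Level) : Set (lsuc (c ⊔ ℓ₁ ⊔ ℓ₂)) where
  field
    commutativeRing : CommutativeRing c ℓ₁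
  open CommutativeRing commutativeRing public
  field
    _<F_               : Rel Carrier ℓ₂
    isStrictTotalOrder : IsStrictTotalOrder _≈_ _<F_
    0<1                : 0# <F 1#
    +-mono-<           : ∀ {x y} z → x <F y → (x + z) <F (y + z)
    *-pos              : ∀ {x y} → 0# <F x → 0# <F y → 0# <F (x * y)
    inverse            : ∀ x → ¬ (x ≈ 0#) → ∃ λ y → (x * y) ≈ 1#

-- ⌈ a / b ⌉ for b ≥ 1 (junk value 0 for b = 0)
ceilDiv : ℕ → ℕ → ℕ
ceilDiv a zero    = 0
ceilDiv a (suc b) = (a +ℕ b) / suc b

module Mat {c ℓ₁ ℓ₂} (F : OrderedField c ℓ₁ ℓ₂) where
  open OrderedField F

  Matrix : ℕ → Set c
  Matrix n = Fin n → Fin n → Carrier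

  sumF : (n : ℕ) → (Fin n → Carrier) → Carrier
  sumF zero    f = 0#
  sumF (suc n) f = f fzero + sumF n (λ k → f (fsuc k))

  sgn : ℕ → Carrier
  sgn zero    = 1#
  sgn (suc k) = - sgn k

  det : (n : ℕ) → Matrix n → Carrier
  det zero    M = 1#
  det (suc n) M =
    sumF (suc n) (λ j → sgn (toℕ j) * (M fzero j * det n (λ r k → M (fsuc r) (punchIn j k))))

  _⊗_ : ∀ {n} → Matrix n → Matrix n → Matrix n
  _⊗_ {n} M N i j = sumF n (λ k → M i k * N k j)

  δ : ℕ → ℕ → Carrier
  δ p q with p ≟ q
  ... | yes _ = 1#
  ... | no  _ = 0#

  I : ∀ {n} → Matrix n
  I i j = δ (toℕ i) (toℕ j)

  _^M_ : ∀ {n} → Matrix n → ℕ → Matrix n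
  M ^M zero    = I
  M ^M suc w   = M ⊗ (M ^M w)

  -- L_i(q) = I + q E_{i,i-1}, indices 1-based: entry at row i, column i-1.
  -- With 0-based Fin indices r, k: row r+1 = i, column k+1 = i-1.
  L : ∀ {n} → ℕ → Carrier → Matrix n
  L i q r k with suc (toℕ r) ≟ i | suc (suc (toℕ k)) ≟ i
  ... | yes _ | yes _ = q
  ... | _     | _     = δ (toℕ r) (toℕ k)

  -- a i j = a^{(i)}_j
  -- Wseg n a i m i₀ = L_{i₀+m-1}(a i (i₀+m-1)) ⋯ L_{i₀}(a i i₀)
  Wseg : (n : ℕ) → (ℕ → ℕ → Carrier) → ℕ → ℕ → ℕ → Matrix n
  Wseg n a i zero    j = I
  Wseg n a i (suc m) j = Wseg n a i m (suc j) ⊗ L j (a i j)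

  W : (n : ℕ) → (ℕ → ℕ → Carrier) → ℕ → Matrix n
  W n a i = Wseg n a i (suc n ∸ i) i

  Aseg : (n : ℕ) → (ℕ → ℕ → Carrier) → ℕ → ℕ → Matrix n
  Aseg n a zero    i = I
  Aseg n a (suc m) i = W n a i ⊗ Aseg n a m (suc i)

  Amat : (n s : ℕ) → (ℕ → ℕ → Carrier) → Matrix n
  Amat n s a = Aseg n a (s ∸ 1) 2

  -- lower-left corner minor M({n-c+1,…,n} | {1,…,c})
  cornerMinor : ∀ {n} → Matrix n → (c : ℕ) → c ≤ n → Carrier
  cornerMinor {n} M c c≤n =
    det c (λ r k → M (cast (m∸n+n≡m c≤n) ((n ∸ c) ↑ʳ r)) (inject≤ k c≤n))

  CornerPos : ∀ {n} → Matrix n → Set ℓ₂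
  CornerPos {n} M = ∀ c → 1 ≤ c → (c<n : c < n) →
    0# <F cornerMinor M c (<⇒≤ c<n)

  IsRl : ∀ {n} → Matrix n → ℕ → Set ℓ₂
  IsRl M w = (1 ≤ w) × CornerPos (M ^M w) ×
             (∀ w′ → 1 ≤ w′ → w′ < w → ¬ CornerPos (M ^M w′))

module Submission where

-- The minors of a product of elementary bidiagonal factors L_i(q), q > 0, obey a
-- Lindström–Gessel–Viennot rule: multiplying by L_i(q) on the left adds q times row i - 2
-- to row i - 1, so by linearity of the determinant a minor with rows ρ becomes the old minor
-- plus q times the minor in which one row of ρ has been lifted by one, and that term vanishes
-- when the lifted row collides with another one.  Hence every minor of such a product is
-- nonnegative, and positive exactly when the factors, read from left to right, can lift the
-- rows ρ to the top rows without collisions.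
--
-- The lower-left corner minor of size κ starts with its rows n - κ below the top.  A factor
-- W_i = L_n ⋯ L_i with i ≤ k + 2 lifts row k all the way, so A = W_2 ⋯ W_s lifts s - 1 rows
-- and A^w has all corner minors positive once n - 1 ≤ w (s - 1).  Conversely, for κ = n - 1
-- every row must be lifted by exactly one, in order, row m by L_{m+2}; a descending product
-- W_i can do this for at most one row, so the corner minor of size n - 1 of A^w vanishes when
-- w (s - 1) < n - 1.

open import Data.Nat using (ℕ; _≤_; _∸_)
open import Defs
open import Data.Nat as N using (zero; suc; _<_; z≤n; s≤s; _<?_) renaming (_+_ to _+ℕ_; _*_ to _*ℕ_)
import Data.Nat.Properties as NP
open import Data.Fin using (Fin; toℕ; punchIn; fromℕ<; _↑ʳ_) renaming (zero to fzero; suc to fsuc)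
open import Data.Fin.Properties using (punchInᵢ≢i; toℕ<n; toℕ-fromℕ<; toℕ-cast; toℕ-↑ʳ; toℕ-inject≤)
open import Relation.Binary.PropositionalEquality as P using (_≡_; _≢_)
open import Data.Product using (∃; _×_; _,_; proj₁; proj₂)
open import Data.Sum using (_⊎_; inj₁; inj₂)
open import Data.Empty using (⊥-elim)
open import Data.Nat.DivMod using (_/_; _%_; m≡m%n+[m/n]*n; m%n<n; m/n*n≤m; m≥n⇒m/n>0)
open import Function using (_∘_)
open import Level using (_⊔_)
open import Data.List using (List; []; _∷_; _++_)
import Data.List.Properties as ListP
open import Data.List.Relation.Unary.All using (All; []; _∷_)
open import Data.List.Relation.Unary.All.Properties using (++⁺)
open import Relation.Nullary using (¬_; yes; no; Dec)
open import Algebra.Bundles using (CommutativeRing)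
import Algebra.Solver.Ring.NaturalCoefficients.Default as Solver
import Algebra.Properties.Ring as RingProperties
import Algebra.Properties.Semiring.Sum as SemiringSum
open import Relation.Binary.Structures using (IsStrictTotalOrder)
open import Relation.Binary.Definitions using (tri<; tri≈; tri>)

m≤ceilDiv*n : ∀ m n → m ≤ ceilDiv m (suc n) *ℕ suc n
m≤ceilDiv*n m n = NP.+-cancelʳ-≤ n m _ (begin
  m +ℕ n                                     ≡⟨ m≡m%n+[m/n]*n (m +ℕ n) (suc n) ⟩
  (m +ℕ n) % suc n +ℕ q *ℕ suc n             ≤⟨ NP.+-monoˡ-≤ (q *ℕ suc n) (NP.m<1+n⇒m≤n (m%n<n (m +ℕ n) (suc n))) ⟩
  n +ℕ q *ℕ suc n                            ≡⟨ NP.+-comm n (q *ℕ suc n) ⟩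
  q *ℕ suc n +ℕ n                            ∎)
  where
  open NP.≤-Reasoning
  q = (m +ℕ n) / suc n

<ceilDiv⇒*n< : ∀ m n w → w < ceilDiv m (suc n) → w *ℕ suc n < m
<ceilDiv⇒*n< m n w w<q = NP.+-cancelʳ-≤ n (suc (w *ℕ suc n)) m (begin
  suc (w *ℕ suc n) +ℕ n                      ≡⟨ P.cong suc (NP.+-comm (w *ℕ suc n) n) ⟩
  suc w *ℕ suc n                             ≤⟨ NP.*-monoˡ-≤ (suc n) w<q ⟩
  ((m +ℕ n) / suc n) *ℕ suc n                ≤⟨ m/n*n≤m (m +ℕ n) (suc n) ⟩
  m +ℕ n                                     ∎)
  where open NP.≤-Reasoning

ceilDiv>0 : ∀ m n → 1 ≤ m → 1 ≤ ceilDiv m (suc n)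
ceilDiv>0 m n 1≤m = m≥n⇒m/n>0 (NP.+-monoˡ-≤ n 1≤m)

replaceAt : (ℕ → ℕ) → ℕ → ℕ → ℕ → ℕ
replaceAt ρ r₀ x r with r N.≟ r₀
... | yes _ = x
... | no  _ = ρ r

replaceAt-≡ : ∀ ρ r₀ x → replaceAt ρ r₀ x r₀ ≡ x
replaceAt-≡ ρ r₀ x with r₀ N.≟ r₀
... | yes _    = P.refl
... | no  r₀≢r₀ = ⊥-elim (r₀≢r₀ P.refl)

replaceAt-≢ : ∀ ρ r₀ x {r} → r ≢ r₀ → replaceAt ρ r₀ x r ≡ ρ r
replaceAt-≢ ρ r₀ x {r} r≢r₀ with r N.≟ r₀
... | yes r≡r₀ = ⊥-elim (r≢r₀ r≡r₀)
... | no  _    = P.refl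

replaceAt-cases : ∀ ρ r₀ x r →
                  (r ≡ r₀ × replaceAt ρ r₀ x r ≡ x) ⊎ (r ≢ r₀ × replaceAt ρ r₀ x r ≡ ρ r)
replaceAt-cases ρ r₀ x r with r N.≟ r₀
... | yes r≡r₀ = inj₁ (r≡r₀ , P.refl)
... | no  r≢r₀ = inj₂ (r≢r₀ , P.refl)

replaceAt-self : ∀ ρ r₀ x → ρ r₀ ≡ x → ∀ r → replaceAt ρ r₀ x r ≡ ρ r
replaceAt-self ρ r₀ x ρr₀≡x r with replaceAt-cases ρ r₀ x r
... | inj₁ (P.refl , e) = P.trans e (P.sym ρr₀≡x)
... | inj₂ (_ , e)      = e

replaceAt-replaceAt : ∀ ρ r₀ x y r → replaceAt (replaceAt ρ r₀ x) r₀ y r ≡ replaceAt ρ r₀ y r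
replaceAt-replaceAt ρ r₀ x y r with replaceAt-cases (replaceAt ρ r₀ x) r₀ y r | replaceAt-cases ρ r₀ y r
... | inj₁ (_ , e)      | inj₁ (_ , e′)     = P.trans e (P.sym e′)
... | inj₁ (r≡r₀ , _)   | inj₂ (r≢r₀ , _)  = ⊥-elim (r≢r₀ r≡r₀)
... | inj₂ (r≢r₀ , _)   | inj₁ (r≡r₀ , _)  = ⊥-elim (r≢r₀ r≡r₀)
... | inj₂ (r≢r₀ , e)   | inj₂ (_ , e′)     = P.trans e (P.trans (replaceAt-≢ ρ r₀ x r≢r₀) (P.sym e′))

module _ {c ℓ₁ ℓ₂} (F : OrderedField c ℓ₁ ℓ₂) where
  open OrderedField F
  open Mat F
  open import Relation.Binary.Reasoning.Setoid setoid
  open Solver (CommutativeRing.commutativeSemiring commutativeRing) using (solve; _:=_; _:+_; _:*_)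
  open RingProperties (CommutativeRing.ring commutativeRing)
    using (-‿distribˡ-*; -‿distribʳ-*; -‿involutive; -‿+-comm; x+x≈x⇒x≈0; -0#≈0#; +-cancelˡ)
  open SemiringSum semiring
    using (sum; sum-replicate-zero; ∑-distrib-+; ∑-comm; sum-remove; *-distribˡ-sum; *-distribʳ-sum)
  open IsStrictTotalOrder isStrictTotalOrder using (compare; irrefl; <-resp-≈) renaming (trans to <-trans)

  -- Ordered fields

  <-respʳ : ∀ {x y z} → y ≈ z → x <F y → x <F z
  <-respʳ = proj₁ <-resp-≈

  <-respˡ : ∀ {x y z} → y ≈ z → y <F x → z <F x
  <-respˡ = proj₂ <-resp-≈

  NonNegative : Carrier → Set (ℓ₁ ⊔ ℓ₂)
  NonNegative x = x ≈ 0# ⊎ 0# <F x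

  NonNegative-resp : ∀ {x y} → x ≈ y → NonNegative x → NonNegative y
  NonNegative-resp x≈y (inj₁ x≈0) = inj₁ (trans (sym x≈y) x≈0)
  NonNegative-resp x≈y (inj₂ 0<x) = inj₂ (<-respʳ x≈y 0<x)

  pos+nonneg : ∀ {x y} → 0# <F x → NonNegative y → 0# <F (x + y)
  pos+nonneg {x} {y} 0<x (inj₁ y≈0) = <-respʳ (sym (trans (+-cong refl y≈0) (+-identityʳ x))) 0<x
  pos+nonneg {x} {y} 0<x (inj₂ 0<y) = <-trans (<-respʳ (sym (+-identityˡ y)) 0<y) (+-mono-< y 0<x)

  nonneg+pos : ∀ {x y} → NonNegative x → 0# <F y → 0# <F (x + y)
  nonneg+pos {x} {y} x≥0 0<y = <-respʳ (+-comm y x) (pos+nonneg 0<y x≥0)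

  nonneg+nonneg : ∀ {x y} → NonNegative x → NonNegative y → NonNegative (x + y)
  nonneg+nonneg {x} {y} (inj₁ x≈0) y≥0 =
    NonNegative-resp (trans (sym (+-identityˡ y)) (+-cong (sym x≈0) refl)) y≥0
  nonneg+nonneg         (inj₂ 0<x) y≥0 = inj₂ (pos+nonneg 0<x y≥0)

  pos*nonneg : ∀ {q y} → 0# <F q → NonNegative y → NonNegative (q * y)
  pos*nonneg {q} 0<q (inj₁ y≈0) = inj₁ (trans (*-cong refl y≈0) (zeroʳ q))
  pos*nonneg     0<q (inj₂ 0<y) = inj₂ (*-pos 0<q 0<y)

  x+x≈0⇒x≈0 : ∀ x → x + x ≈ 0# → x ≈ 0#
  x+x≈0⇒x≈0 x eq with compare x 0#
  ... | tri< x<0 _ _ =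
        ⊥-elim (irrefl refl (<-respˡ eq (<-trans (+-mono-< x x<0) (<-respˡ (sym (+-identityˡ x)) x<0))))
  ... | tri≈ _ x≈0 _ = x≈0
  ... | tri> _ _ 0<x =
        ⊥-elim (irrefl refl (<-respʳ eq (<-trans (<-respʳ (sym (+-identityˡ x)) 0<x) (+-mono-< x 0<x))))

  -- Finite sums

  sumF≈sum : ∀ n (f : Fin n → Carrier) → sumF n f ≈ sum f
  sumF≈sum zero    f = refl
  sumF≈sum (suc n) f = +-cong refl (sumF≈sum n (λ k → f (fsuc k)))

  sumF-cong : ∀ n {f g : Fin n → Carrier} → (∀ k → f k ≈ g k) → sumF n f ≈ sumF n g
  sumF-cong zero    eq = refl
  sumF-cong (suc n) eq = +-cong (eq fzero) (sumF-cong n (λ k → eq (fsuc k)))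

  sumF-zero : ∀ n (f : Fin n → Carrier) → (∀ k → f k ≈ 0#) → sumF n f ≈ 0#
  sumF-zero n f eq = trans (sumF-cong n eq) (trans (sumF≈sum n _) (sum-replicate-zero n))

  sumF-distrib-+ : ∀ n (f g : Fin n → Carrier) → sumF n (λ k → f k + g k) ≈ sumF n f + sumF n g
  sumF-distrib-+ n f g =
    trans (sumF≈sum n _) (trans (∑-distrib-+ f g) (sym (+-cong (sumF≈sum n f) (sumF≈sum n g))))

  *-distribˡ-sumF : ∀ n a (f : Fin n → Carrier) → a * sumF n f ≈ sumF n (λ k → a * f k)
  *-distribˡ-sumF n a f = trans (*-cong refl (sumF≈sum n f)) (trans (*-distribˡ-sum a f) (sym (sumF≈sum n _)))

  sumF-neg : ∀ n (f : Fin n → Carrier) → sumF n (λ k → - f k) ≈ - sumF n f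
  sumF-neg zero    f = sym -0#≈0#
  sumF-neg (suc n) f = trans (+-cong refl (sumF-neg n _)) (-‿+-comm _ _)

  sumF-remove : ∀ m (f : Fin (suc m) → Carrier) j → sumF (suc m) f ≈ f j + sumF m (λ k → f (punchIn j k))
  sumF-remove m f j = trans (sumF≈sum (suc m) f) (trans (sum-remove f) (+-cong refl (sym (sumF≈sum m _))))

  sumF-comm : ∀ n m (f : Fin n → Fin m → Carrier) →
              sumF n (λ i → sumF m (f i)) ≈ sumF m (λ j → sumF n (λ i → f i j))
  sumF-comm n m f = trans (sumF²≈sum² n m f) (trans (∑-comm f) (sym (sumF²≈sum² m n (λ j i → f i j))))
    where
    sumF²≈sum² : ∀ n m (f : Fin n → Fin m → Carrier) → sumF n (λ i → sumF m (f i)) ≈ sum (λ i → sum (f i))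
    sumF²≈sum² n m f = trans (sumF-cong n (λ i → sumF≈sum m (f i))) (sumF≈sum n _)

  sumF-linear : ∀ n {f g h : Fin n → Carrier} q → (∀ k → f k ≈ g k + q * h k) →
                sumF n f ≈ sumF n g + q * sumF n h
  sumF-linear n {f} {g} {h} q eq = begin
    sumF n f                                   ≈⟨ sumF-cong n eq ⟩
    sumF n (λ k → g k + q * h k)               ≈⟨ sumF-distrib-+ n g _ ⟩
    sumF n g + sumF n (λ k → q * h k)          ≈⟨ +-cong refl (*-distribˡ-sumF n q h) ⟨
    sumF n g + q * sumF n h                    ∎

  -- Determinants

  detRows : ∀ n → (ℕ → Fin n → Carrier) → Carrier
  detRows n G = det n (λ r k → G (toℕ r) k)

  firstRowMinor : ∀ {n} → (ℕ → Fin (suc n) → Carrier) → Fin (suc n) → Carrier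
  firstRowMinor {n} G j = detRows n (λ r k → G (suc r) (punchIn j k))

  det-cong : ∀ n {M M′ : Matrix n} → (∀ r k → M r k ≈ M′ r k) → det n M ≈ det n M′
  det-cong zero    eq = refl
  det-cong (suc n) eq = sumF-cong (suc n) (λ j →
    *-cong (refl {sgn (toℕ j)}) (*-cong (eq fzero j) (det-cong n (λ r k → eq (fsuc r) (punchIn j k)))))

  detRows-linear : ∀ n (X Y Z : ℕ → Fin n → Carrier) q r₀ → r₀ < n →
    (∀ r → r < n → r ≢ r₀ → ∀ k → X r k ≈ Y r k) →
    (∀ r → r < n → r ≢ r₀ → ∀ k → Z r k ≈ Y r k) →
    (∀ k → X r₀ k ≈ Y r₀ k + q * Z r₀ k) →
    detRows n X ≈ detRows n Y + q * detRows n Z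
  detRows-linear (suc n) X Y Z q zero _ hX hZ h₀ = sumF-linear (suc n) q (λ j → begin
      sgn (toℕ j) * (X 0 j * firstRowMinor X j)
        ≈⟨ *-cong refl (*-cong (h₀ j) (minor≈ hX j)) ⟩
      sgn (toℕ j) * ((Y 0 j + q * Z 0 j) * firstRowMinor Y j)
        ≈⟨ solve 5 (λ s y q z d → s :* ((y :+ q :* z) :* d) := s :* (y :* d) :+ q :* (s :* (z :* d)))
                   refl _ _ _ _ _ ⟩
      sgn (toℕ j) * (Y 0 j * firstRowMinor Y j) + q * (sgn (toℕ j) * (Z 0 j * firstRowMinor Y j))
        ≈⟨ +-cong refl (*-cong refl (*-cong refl (*-cong refl (minor≈ hZ j)))) ⟨
      sgn (toℕ j) * (Y 0 j * firstRowMinor Y j) + q * (sgn (toℕ j) * (Z 0 j * firstRowMinor Z j)) ∎)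
    where
    minor≈ : ∀ {V} → (∀ r → r < suc n → r ≢ 0 → ∀ k → V r k ≈ Y r k) →
             ∀ j → firstRowMinor V j ≈ firstRowMinor Y j
    minor≈ h j = det-cong n (λ r k → h (suc (toℕ r)) (s≤s (toℕ<n r)) (λ ()) (punchIn j k))
  detRows-linear (suc n) X Y Z q (suc r₀) (s≤s r₀<n) hX hZ h₀ = sumF-linear (suc n) q (λ j → begin
      sgn (toℕ j) * (X 0 j * firstRowMinor X j)
        ≈⟨ *-cong refl (*-cong (hX 0 (s≤s z≤n) (λ ()) j) (minor-linear j)) ⟩
      sgn (toℕ j) * (Y 0 j * (firstRowMinor Y j + q * firstRowMinor Z j))
        ≈⟨ solve 5 (λ s y q z d → s :* (y :* (d :+ q :* z)) := s :* (y :* d) :+ q :* (s :* (y :* z)))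
                   refl _ _ _ _ _ ⟩
      sgn (toℕ j) * (Y 0 j * firstRowMinor Y j) + q * (sgn (toℕ j) * (Y 0 j * firstRowMinor Z j))
        ≈⟨ +-cong refl (*-cong refl (*-cong refl (*-cong (hZ 0 (s≤s z≤n) (λ ()) j) refl))) ⟨
      sgn (toℕ j) * (Y 0 j * firstRowMinor Y j) + q * (sgn (toℕ j) * (Z 0 j * firstRowMinor Z j)) ∎)
    where
    shifted : ∀ {V W : ℕ → Fin (suc n) → Carrier} → (∀ r → r < suc n → r ≢ suc r₀ → ∀ k → V r k ≈ W r k) →
              ∀ j r → r < n → r ≢ r₀ → ∀ k → V (suc r) (punchIn j k) ≈ W (suc r) (punchIn j k)
    shifted h j r r<n r≢r₀ k = h (suc r) (s≤s r<n) (λ e → r≢r₀ (NP.suc-injective e)) (punchIn j k)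
    minor-linear : ∀ j → firstRowMinor X j ≈ firstRowMinor Y j + q * firstRowMinor Z j
    minor-linear j = detRows-linear n _ _ _ q r₀ r₀<n (shifted hX j) (shifted hZ j) (λ k → h₀ (punchIn j k))

  detRows-zero-row : ∀ n (G : ℕ → Fin n → Carrier) r₀ → r₀ < n → (∀ k → G r₀ k ≈ 0#) → detRows n G ≈ 0#
  detRows-zero-row n G r₀ r₀<n zero-row = x+x≈x⇒x≈0 _ (sym (trans D≈D+1D (+-cong refl (*-identityˡ _))))
    where
    -- a zero row is the sum of two zero rows
    D≈D+1D : detRows n G ≈ detRows n G + 1# * detRows n G
    D≈D+1D = detRows-linear n G G G 1# r₀ r₀<n (λ _ _ _ _ → refl) (λ _ _ _ _ → refl) (λ k → begin
      G r₀ k                  ≈⟨ zero-row k ⟩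
      0#                      ≈⟨ trans (+-identityˡ _) (zeroʳ 1#) ⟨
      0# + 1# * 0#            ≈⟨ +-cong (zero-row k) (*-cong refl (zero-row k)) ⟨
      G r₀ k + 1# * G r₀ k    ∎)

  -- This is where the characteristic of an ordered field (≠ 2) is used.
  sumF-offDiagonal-antisym : ∀ m (h : Fin (suc m) → Fin (suc m) → Carrier) →
    (∀ x y → x ≢ y → h x y ≈ - h y x) →
    sumF (suc m) (λ x → sumF m (λ k → h x (punchIn x k))) ≈ 0#
  sumF-offDiagonal-antisym m h anti = x+x≈0⇒x≈0 S (trans (+-cong refl S≈-S) (-‿inverseʳ S))
    where
    S D : Carrier
    S = sumF (suc m) (λ x → sumF m (λ k → h x (punchIn x k)))
    D = sumF (suc m) (λ x → h x x)
    by-rows : sumF (suc m) (λ x → sumF (suc m) (h x)) ≈ D + S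
    by-rows = trans (sumF-cong (suc m) (λ x → sumF-remove m (h x) x))
                    (sumF-distrib-+ (suc m) (λ x → h x x) (λ x → sumF m (λ k → h x (punchIn x k))))
    by-columns : sumF (suc m) (λ y → sumF (suc m) (λ x → h x y)) ≈ D + - S
    by-columns = begin
      sumF (suc m) (λ y → sumF (suc m) (λ x → h x y))
        ≈⟨ sumF-cong (suc m) (λ y → trans (sumF-remove m (λ x → h x y) y)
             (+-cong refl (sumF-cong m (λ k → anti (punchIn y k) y (punchInᵢ≢i y k))))) ⟩
      sumF (suc m) (λ y → h y y + sumF m (λ k → - h y (punchIn y k)))
        ≈⟨ sumF-distrib-+ (suc m) (λ y → h y y) (λ y → sumF m (λ k → - h y (punchIn y k))) ⟩
      D + sumF (suc m) (λ y → sumF m (λ k → - h y (punchIn y k)))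
        ≈⟨ +-cong refl (trans (sumF-cong (suc m) (λ y → sumF-neg m (λ k → h y (punchIn y k))))
                               (sumF-neg (suc m) (λ y → sumF m (λ k → h y (punchIn y k))))) ⟩
      D + - S ∎
    S≈-S : S ≈ - S
    S≈-S = +-cancelˡ D S (- S) (trans (sym by-rows) (trans (sumF-comm (suc m) (suc m) h) by-columns))

  -- A total version of punchOut; its value at the diagonal is junk.
  punchOut′ : ∀ {m} → Fin (suc (suc m)) → Fin (suc (suc m)) → Fin (suc m)
  punchOut′ fzero    fzero    = fzero
  punchOut′ fzero    (fsuc y) = y
  punchOut′ (fsuc x) fzero    = fzero
  punchOut′ {zero}  (fsuc x) (fsuc y) = fzero
  punchOut′ {suc m} (fsuc x) (fsuc y) = fsuc (punchOut′ x y)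

  punchOut′-punchIn : ∀ {m} (j : Fin (suc (suc m))) k → punchOut′ j (punchIn j k) ≡ k
  punchOut′-punchIn fzero    k        = P.refl
  punchOut′-punchIn (fsuc j) fzero    = P.refl
  punchOut′-punchIn {suc m} (fsuc j) (fsuc k) = P.cong fsuc (punchOut′-punchIn j k)

  punchIn-punchOut′-comm : ∀ {m} (x y : Fin (suc (suc m))) → x ≢ y → ∀ l →
    punchIn x (punchIn (punchOut′ x y) l) ≡ punchIn y (punchIn (punchOut′ y x) l)
  punchIn-punchOut′-comm fzero    fzero    x≢y l = ⊥-elim (x≢y P.refl)
  punchIn-punchOut′-comm fzero    (fsuc y) x≢y l = P.refl
  punchIn-punchOut′-comm (fsuc x) fzero    x≢y l = P.refl
  punchIn-punchOut′-comm {suc m} (fsuc x) (fsuc y) x≢y fzero    = P.refl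
  punchIn-punchOut′-comm {suc m} (fsuc x) (fsuc y) x≢y (fsuc l) =
    P.cong fsuc (punchIn-punchOut′-comm x y (λ e → x≢y (P.cong fsuc e)) l)

  sgn-punchOut′-antisym : ∀ {m} (x y : Fin (suc (suc m))) → x ≢ y →
    sgn (toℕ x) * sgn (toℕ (punchOut′ x y)) ≈ - (sgn (toℕ y) * sgn (toℕ (punchOut′ y x)))
  sgn-punchOut′-antisym fzero fzero x≢y = ⊥-elim (x≢y P.refl)
  sgn-punchOut′-antisym fzero (fsuc y) x≢y = begin
    1# * sgn (toℕ y)            ≈⟨ *-comm _ _ ⟩
    sgn (toℕ y) * 1#            ≈⟨ -‿involutive _ ⟨
    - (- (sgn (toℕ y) * 1#))    ≈⟨ -‿cong (-‿distribˡ-* _ _) ⟩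
    - ((- sgn (toℕ y)) * 1#)    ∎
  sgn-punchOut′-antisym (fsuc x) fzero x≢y = begin
    (- sgn (toℕ x)) * 1#        ≈⟨ -‿distribˡ-* _ _ ⟨
    - (sgn (toℕ x) * 1#)        ≈⟨ -‿cong (*-comm _ _) ⟩
    - (1# * sgn (toℕ x))        ∎
  sgn-punchOut′-antisym {zero} (fsuc fzero) (fsuc fzero) x≢y = ⊥-elim (x≢y P.refl)
  sgn-punchOut′-antisym {suc m} (fsuc x) (fsuc y) x≢y = begin
    (- sgn (toℕ x)) * (- sgn (toℕ (punchOut′ x y)))     ≈⟨ -x*-y≈xy _ _ ⟩
    sgn (toℕ x) * sgn (toℕ (punchOut′ x y))             ≈⟨ sgn-punchOut′-antisym x y (λ e → x≢y (P.cong fsuc e)) ⟩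
    - (sgn (toℕ y) * sgn (toℕ (punchOut′ y x)))         ≈⟨ -‿cong (-x*-y≈xy _ _) ⟨
    - ((- sgn (toℕ y)) * (- sgn (toℕ (punchOut′ y x)))) ∎
    where
    -x*-y≈xy : ∀ a b → (- a) * (- b) ≈ a * b
    -x*-y≈xy a b = trans (sym (-‿distribˡ-* a (- b))) (trans (-‿cong (sym (-‿distribʳ-* a b))) (-‿involutive _))

  -- Expanding along the first two rows pairs the terms with column choices (x, y) and (y, x),
  -- which cancel when the two rows agree.
  det-equal-first-rows : ∀ m (M : Matrix (suc (suc m))) → (∀ k → M fzero k ≈ M (fsuc fzero) k) →
                         det (suc (suc m)) M ≈ 0#
  det-equal-first-rows m M row₀≈row₁ =
    trans (sumF-cong (suc (suc m)) expand) (sumF-offDiagonal-antisym (suc m) h antisym)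
    where
    v : Fin (suc (suc m)) → Carrier
    v = M fzero
    rest : Fin (suc (suc m)) → Fin (suc (suc m)) → Carrier
    rest x y = det m (λ r l → M (fsuc (fsuc r)) (punchIn x (punchIn (punchOut′ x y) l)))
    h : Fin (suc (suc m)) → Fin (suc (suc m)) → Carrier
    h x y = (sgn (toℕ x) * sgn (toℕ (punchOut′ x y))) * ((v x * v y) * rest x y)
    term : ∀ j k → h j (punchIn j k) ≈
      (sgn (toℕ j) * sgn (toℕ k)) * ((v j * v (punchIn j k)) * det m (λ r l → M (fsuc (fsuc r)) (punchIn j (punchIn k l))))
    term j k rewrite punchOut′-punchIn j k = refl
    expand : ∀ j → sgn (toℕ j) * (v j * det (suc m) (λ r k → M (fsuc r) (punchIn j k))) ≈
                   sumF (suc m) (λ k → h j (punchIn j k))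
    expand j = trans (*-cong refl (*-distribˡ-sumF (suc m) (v j) cofactorTerm))
                     (trans (*-distribˡ-sumF (suc m) (sgn (toℕ j)) (λ k → v j * cofactorTerm k))
      (sumF-cong (suc m) (λ k → trans
        (*-cong refl (*-cong refl (*-cong refl (*-cong (sym (row₀≈row₁ (punchIn j k))) refl))))
        (trans (solve 5 (λ a b c d e → a :* (b :* (c :* (d :* e))) := (a :* c) :* ((b :* d) :* e)) refl _ _ _ _ _)
               (sym (term j k))))))
      where
      cofactorTerm : Fin (suc m) → Carrier
      cofactorTerm k = sgn (toℕ k) * (M (fsuc fzero) (punchIn j k) *
                                      det m (λ r l → M (fsuc (fsuc r)) (punchIn j (punchIn k l))))
    antisym : ∀ x y → x ≢ y → h x y ≈ - h y x
    antisym x y x≢y = trans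
      (*-cong (sgn-punchOut′-antisym x y x≢y) (*-cong (*-comm (v x) (v y))
        (det-cong m (λ r l → reflexive (P.cong (M (fsuc (fsuc r))) (punchIn-punchOut′-comm x y x≢y l))))))
      (sym (-‿distribˡ-* _ _))

  detRows-equal-adjacent : ∀ n (G : ℕ → Fin n → Carrier) r → suc r < n → (∀ k → G r k ≈ G (suc r) k) →
                           detRows n G ≈ 0#
  detRows-equal-adjacent (suc (suc m)) G zero    _          eq = det-equal-first-rows m (λ r → G (toℕ r)) eq
  detRows-equal-adjacent (suc n)       G (suc r) (s≤s r<n) eq =
    sumF-zero (suc n) (λ j → sgn (toℕ j) * (G 0 j * firstRowMinor G j)) (λ j →
    trans (*-cong refl (trans (*-cong refl
      (detRows-equal-adjacent n (λ x k → G (suc x) (punchIn j k)) r r<n (λ k → eq (punchIn j k))))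
      (zeroʳ _))) (zeroʳ _))

  -- Entries and products

  δ-≡ : ∀ p q → p ≡ q → δ p q ≡ 1#
  δ-≡ p q p≡q with p N.≟ q
  ... | yes _   = P.refl
  ... | no  p≢q = ⊥-elim (p≢q p≡q)

  δ-≢ : ∀ p q → p ≢ q → δ p q ≡ 0#
  δ-≢ p q p≢q with p N.≟ q
  ... | yes p≡q = ⊥-elim (p≢q p≡q)
  ... | no  _   = P.refl

  δ-sym : ∀ p q → δ p q ≡ δ q p
  δ-sym p q with p N.≟ q
  ... | yes p≡q = P.sym (δ-≡ q p (P.sym p≡q))
  ... | no  p≢q = P.sym (δ-≢ q p (p≢q ∘ P.sym))

  δ-suc : ∀ p q → δ (suc p) (suc q) ≡ δ p q
  δ-suc p q with p N.≟ q
  ... | yes p≡q = δ-≡ (suc p) (suc q) (P.cong suc p≡q)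
  ... | no  p≢q = δ-≢ (suc p) (suc q) (p≢q ∘ NP.suc-injective)

  detRows-δ : ∀ m → detRows m (λ r k → δ r (toℕ k)) ≈ 1#
  detRows-δ zero    = refl
  detRows-δ (suc m) = begin
      sgn 0 * (δ 0 0 * firstRowMinor G fzero) +
        sumF m (λ j → sgn (suc (toℕ j)) * (δ 0 (suc (toℕ j)) * firstRowMinor G (fsuc j)))
    ≈⟨ +-cong (*-cong refl (*-cong (reflexive (δ-≡ 0 0 P.refl))
                 (trans (det-cong m (λ r k → reflexive (δ-suc (toℕ r) (toℕ k)))) (detRows-δ m))))
              (sumF-zero m _ (λ j → trans (*-cong refl
                (trans (*-cong (reflexive (δ-≢ 0 (suc (toℕ j)) (λ ()))) refl) (zeroˡ _))) (zeroʳ _))) ⟩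
      1# * (1# * 1#) + 0#
    ≈⟨ trans (+-identityʳ _) (trans (*-identityˡ _) (*-identityˡ _)) ⟩
      1# ∎
    where
    G : ℕ → Fin (suc m) → Carrier
    G r k = δ r (toℕ k)

  -- Entries addressed by natural numbers, with junk value 0# out of range.
  lookupℕ : ∀ {n} → (Fin n → Carrier) → ℕ → Carrier
  lookupℕ {zero}  f p       = 0#
  lookupℕ {suc n} f zero    = f fzero
  lookupℕ {suc n} f (suc p) = lookupℕ (λ x → f (fsuc x)) p

  lookupℕ-toℕ : ∀ {n} (f : Fin n → Carrier) x → lookupℕ f (toℕ x) ≡ f x
  lookupℕ-toℕ f fzero    = P.refl
  lookupℕ-toℕ f (fsuc x) = lookupℕ-toℕ (λ y → f (fsuc y)) x

  lookupℕ-≥ : ∀ {n} (f : Fin n → Carrier) p → n ≤ p → lookupℕ f p ≡ 0#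
  lookupℕ-≥ {zero}  f p       _         = P.refl
  lookupℕ-≥ {suc n} f (suc p) (s≤s n≤p) = lookupℕ-≥ (λ x → f (fsuc x)) p n≤p

  lookupℕ-fromℕ< : ∀ {n} (f : Fin n → Carrier) p (p<n : p < n) → lookupℕ f p ≡ f (fromℕ< p<n)
  lookupℕ-fromℕ< {suc n} f zero    _         = P.refl
  lookupℕ-fromℕ< {suc n} f (suc p) (s≤s p<n) = lookupℕ-fromℕ< (λ x → f (fsuc x)) p p<n

  lookupℕ-cong : ∀ {n} {f g : Fin n → Carrier} → (∀ x → f x ≈ g x) → ∀ p → lookupℕ f p ≈ lookupℕ g p
  lookupℕ-cong {zero}  eq p       = refl
  lookupℕ-cong {suc n} eq zero    = eq fzero
  lookupℕ-cong {suc n} eq (suc p) = lookupℕ-cong (λ x → eq (fsuc x)) p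

  entry : ∀ {n} → Matrix n → ℕ → ℕ → Carrier
  entry M p k = lookupℕ (λ x → lookupℕ (M x) k) p

  entry-toℕ : ∀ {n} (M : Matrix n) x y → entry M (toℕ x) (toℕ y) ≡ M x y
  entry-toℕ M x y = P.trans (lookupℕ-toℕ (λ x → lookupℕ (M x) (toℕ y)) x) (lookupℕ-toℕ (M x) y)

  entry-fromℕ< : ∀ {n} (M : Matrix n) p k (p<n : p < n) (k<n : k < n) → entry M p k ≡ M (fromℕ< p<n) (fromℕ< k<n)
  entry-fromℕ< M p k p<n k<n =
    P.trans (lookupℕ-fromℕ< (λ x → lookupℕ (M x) k) p p<n) (lookupℕ-fromℕ< (M (fromℕ< p<n)) k k<n)

  entry-≥ : ∀ {n} (M : Matrix n) p k → n ≤ p → entry M p k ≡ 0#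
  entry-≥ M p k = lookupℕ-≥ (λ x → lookupℕ (M x) k) p

  entry-cong : ∀ {n} {M M′ : Matrix n} → (∀ x y → M x y ≈ M′ x y) → ∀ p k → entry M p k ≈ entry M′ p k
  entry-cong {M = M} {M′} eq p k = lookupℕ-cong (λ x → lookupℕ-cong (eq x) k) p

  sumF-δ : ∀ n (f : Fin n → Carrier) p → sumF n (λ m → δ (toℕ m) p * f m) ≈ lookupℕ f p
  sumF-δ zero    f p       = refl
  sumF-δ (suc n) f zero    = trans (+-cong (trans (*-cong (reflexive (δ-≡ 0 0 P.refl)) refl) (*-identityˡ _))
    (sumF-zero n _ (λ m → trans (*-cong (reflexive (δ-≢ (suc (toℕ m)) 0 (λ ()))) refl) (zeroˡ _)))) (+-identityʳ _)
  sumF-δ (suc n) f (suc p) = trans (+-cong (trans (*-cong (reflexive (δ-≢ 0 (suc p) (λ ()))) refl) (zeroˡ _))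
    (trans (sumF-cong n (λ m → *-cong (reflexive (δ-suc (toℕ m) p)) refl)) (sumF-δ n (λ x → f (fsuc x)) p)))
    (+-identityˡ _)

  infix 4 _≋_
  _≋_ : ∀ {n} → Matrix n → Matrix n → Set ℓ₁
  M ≋ N = ∀ x y → M x y ≈ N x y

  ≋-refl : ∀ {n} {M : Matrix n} → M ≋ M
  ≋-refl _ _ = refl

  ≋-trans : ∀ {n} {M M′ M″ : Matrix n} → M ≋ M′ → M′ ≋ M″ → M ≋ M″
  ≋-trans M≋M′ M′≋M″ x y = trans (M≋M′ x y) (M′≋M″ x y)

  ≋-reflexive : ∀ {n} {M M′ : Matrix n} → M ≡ M′ → M ≋ M′
  ≋-reflexive P.refl = ≋-refl

  *-distribʳ-sumF : ∀ n a (f : Fin n → Carrier) → sumF n f * a ≈ sumF n (λ k → f k * a)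
  *-distribʳ-sumF n a f = trans (*-cong (sumF≈sum n f) refl) (trans (*-distribʳ-sum a f) (sym (sumF≈sum n _)))

  ⊗-identityˡ : ∀ {n} (N : Matrix n) → I ⊗ N ≋ N
  ⊗-identityˡ {n} N x y = begin
    sumF n (λ m → δ (toℕ x) (toℕ m) * N m y) ≈⟨ sumF-cong n (λ m → *-cong (reflexive (δ-sym (toℕ x) _)) refl) ⟩
    sumF n (λ m → δ (toℕ m) (toℕ x) * N m y) ≈⟨ sumF-δ n (λ m → N m y) (toℕ x) ⟩
    lookupℕ (λ m → N m y) (toℕ x)             ≡⟨ lookupℕ-toℕ (λ m → N m y) x ⟩
    N x y                                     ∎

  ⊗-cong : ∀ {n} {M M′ N N′ : Matrix n} → M ≋ M′ → N ≋ N′ → M ⊗ N ≋ M′ ⊗ N′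
  ⊗-cong {n} M≋M′ N≋N′ x y = sumF-cong n (λ k → *-cong (M≋M′ x k) (N≋N′ k y))

  ⊗-assoc : ∀ {n} (X Y Z : Matrix n) → (X ⊗ Y) ⊗ Z ≋ X ⊗ (Y ⊗ Z)
  ⊗-assoc {n} X Y Z i j = begin
      sumF n (λ k → sumF n (λ m → X i m * Y m k) * Z k j)
    ≈⟨ sumF-cong n (λ k → *-distribʳ-sumF n (Z k j) (λ m → X i m * Y m k)) ⟩
      sumF n (λ k → sumF n (λ m → (X i m * Y m k) * Z k j))
    ≈⟨ sumF-comm n n (λ k m → (X i m * Y m k) * Z k j) ⟩
      sumF n (λ m → sumF n (λ k → (X i m * Y m k) * Z k j))
    ≈⟨ sumF-cong n (λ m → trans (sumF-cong n (λ k → *-assoc (X i m) (Y m k) (Z k j)))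
                             (sym (*-distribˡ-sumF n (X i m) (λ k → Y m k * Z k j)))) ⟩
      sumF n (λ m → X i m * sumF n (λ k → Y m k * Z k j))
    ∎

  2+[i∸2]≡i : ∀ {i} → 2 ≤ i → suc (suc (i ∸ 2)) ≡ i
  2+[i∸2]≡i (s≤s (s≤s _)) = P.refl

  2+[m∸1]≤1+m : ∀ {m} → 1 ≤ m → 2 +ℕ (m ∸ 1) ≤ suc m
  2+[m∸1]≤1+m (s≤s _) = NP.≤-refl

  L-other-row : ∀ {n} i q (x m : Fin n) → suc (toℕ x) ≢ i → L i q x m ≡ δ (toℕ x) (toℕ m)
  L-other-row i q x m x+1≢i with suc (toℕ x) N.≟ i
  ... | yes x+1≡i = ⊥-elim (x+1≢i x+1≡i)
  ... | no _      = P.refl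

  L-row : ∀ {n} i q (x m : Fin n) → 2 ≤ i → suc (toℕ x) ≡ i →
          L i q x m ≈ δ (toℕ x) (toℕ m) + q * δ (toℕ m) (i ∸ 2)
  L-row i q x m 2≤i x+1≡i with suc (toℕ x) N.≟ i | suc (suc (toℕ m)) N.≟ i
  ... | no x+1≢i | _ = ⊥-elim (x+1≢i x+1≡i)
  ... | yes _ | yes m+2≡i = sym (begin
    δ (toℕ x) (toℕ m) + q * δ (toℕ m) (i ∸ 2) ≡⟨ P.cong₂ (λ a b → a + q * b)
                                                     (δ-≢ _ _ x≢m) (δ-≡ _ _ (P.cong (_∸ 2) m+2≡i)) ⟩
    0# + q * 1#                               ≈⟨ trans (+-identityˡ _) (*-identityʳ q) ⟩
    q                                         ∎)
    where
    x≢m : toℕ x ≢ toℕ m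
    x≢m x≡m = NP.1+n≢n (P.trans m+2≡i (P.sym (P.trans (P.cong suc (P.sym x≡m)) x+1≡i)))
  ... | yes _ | no m+2≢i = sym (begin
    δ (toℕ x) (toℕ m) + q * δ (toℕ m) (i ∸ 2) ≡⟨ P.cong (λ b → _ + q * b) (δ-≢ _ _ m≢i∸2) ⟩
    δ (toℕ x) (toℕ m) + q * 0#                ≈⟨ trans (+-cong refl (zeroʳ q)) (+-identityʳ _) ⟩
    δ (toℕ x) (toℕ m)                         ∎)
    where
    m≢i∸2 : toℕ m ≢ i ∸ 2
    m≢i∸2 m≡i∸2 = m+2≢i (P.trans (P.cong (suc ∘ suc) m≡i∸2) (2+[i∸2]≡i 2≤i))

  entry-L⊗-other : ∀ {n} i q (N : Matrix n) p k → k < n → suc p ≢ i → entry (L i q ⊗ N) p k ≈ entry N p k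
  entry-L⊗-other {n} i q N p k k<n p+1≢i with p <? n
  ... | yes p<n = begin
      entry (L i q ⊗ N) p k                           ≡⟨ entry-fromℕ< (L i q ⊗ N) p k p<n k<n ⟩
      sumF n (λ m → L i q x m * N m (fromℕ< k<n))    ≈⟨ sumF-cong n (λ m → *-cong (reflexive (L-other-row _ _ _ m x+1≢i)) refl) ⟩
      (I ⊗ N) x (fromℕ< k<n)                          ≈⟨ ⊗-identityˡ N x (fromℕ< k<n) ⟩
      N x (fromℕ< k<n)                                ≡⟨ P.sym (entry-fromℕ< N p k p<n k<n) ⟩
      entry N p k                                     ∎
    where
    x = fromℕ< p<n
    x+1≢i : suc (toℕ x) ≢ i
    x+1≢i = p+1≢i ∘ P.trans (P.cong suc (P.sym (toℕ-fromℕ< p<n)))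
  ... | no p≮n = reflexive (P.trans (entry-≥ _ p k (NP.≮⇒≥ p≮n)) (P.sym (entry-≥ N p k (NP.≮⇒≥ p≮n))))

  entry-L⊗-row : ∀ {n} i q (N : Matrix n) p k → k < n → 2 ≤ i → i ≤ n → suc p ≡ i →
                 entry (L i q ⊗ N) p k ≈ entry N p k + q * entry N (i ∸ 2) k
  entry-L⊗-row {n} i q N p k k<n 2≤i i≤n p+1≡i = begin
      entry (L i q ⊗ N) p k
    ≡⟨ entry-fromℕ< (L i q ⊗ N) p k p<n k<n ⟩
      sumF n (λ m → L i q x m * N m y)
    ≈⟨ sumF-cong n (λ m → trans (*-cong (L-row i q x m 2≤i x+1≡i) refl)
                                (trans (distribʳ _ _ _) (+-cong refl (*-assoc _ _ _)))) ⟩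
      sumF n (λ m → δ (toℕ x) (toℕ m) * N m y + q * (δ (toℕ m) (i ∸ 2) * N m y))
    ≈⟨ sumF-linear n q (λ _ → refl) ⟩
      (I ⊗ N) x y + q * sumF n (λ m → δ (toℕ m) (i ∸ 2) * N m y)
    ≈⟨ +-cong (⊗-identityˡ N x y) (*-cong refl (sumF-δ n (λ m → N m y) (i ∸ 2))) ⟩
      N x y + q * lookupℕ (λ m → N m y) (i ∸ 2)
    ≡⟨ P.cong₂ (λ a b → a + q * b) (P.sym (entry-fromℕ< N p k p<n k<n))
         (P.trans (lookupℕ-fromℕ< (λ m → N m y) (i ∸ 2) i∸2<n) (P.sym (entry-fromℕ< N (i ∸ 2) k i∸2<n k<n))) ⟩
      entry N p k + q * entry N (i ∸ 2) k
    ∎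
    where
    p<n : p < n
    p<n = NP.≤-trans (NP.≤-reflexive p+1≡i) i≤n
    i∸2<n : i ∸ 2 < n
    i∸2<n = NP.≤-trans (NP.n≤1+n _) (NP.≤-trans (NP.≤-reflexive (2+[i∸2]≡i 2≤i)) i≤n)
    x = fromℕ< p<n
    y = fromℕ< k<n
    x+1≡i : suc (toℕ x) ≡ i
    x+1≡i = P.trans (P.cong suc (toℕ-fromℕ< p<n)) p+1≡i

  module Words (n : ℕ) where

    Word : Set c
    Word = List (ℕ × Carrier)

    evalWord : Word → Matrix n → Matrix n
    evalWord []            N = N
    evalWord ((i , q) ∷ w) N = L i q ⊗ evalWord w N

    evalWord-++ : ∀ w₁ w₂ N → evalWord (w₁ ++ w₂) N ≡ evalWord w₁ (evalWord w₂ N)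
    evalWord-++ []             w₂ N = P.refl
    evalWord-++ ((i , q) ∷ w₁) w₂ N = P.cong (L i q ⊗_) (evalWord-++ w₁ w₂ N)

    PositiveLetter : ℕ × Carrier → Set ℓ₂
    PositiveLetter (i , q) = (2 ≤ i) × (i ≤ n) × (0# <F q)

    PositiveWord : Word → Set (c ⊔ ℓ₂)
    PositiveWord = All PositiveLetter

    descending : (ℕ → Carrier) → ℕ → ℕ → Word
    descending g j zero    = []
    descending g j (suc m) = (j +ℕ m , g (j +ℕ m)) ∷ descending g j m

    descending-+ : ∀ g j m₁ m₂ →
                   descending g j (m₁ +ℕ m₂) ≡ descending g (j +ℕ m₂) m₁ ++ descending g j m₂
    descending-+ g j zero     m₂ = P.refl
    descending-+ g j (suc m₁) m₂ = P.cong₂ _∷_ (P.cong (λ t → (t , g t)) j+[m₁+m₂]≡j+m₂+m₁) (descending-+ g j m₁ m₂)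
      where
      j+[m₁+m₂]≡j+m₂+m₁ : j +ℕ (m₁ +ℕ m₂) ≡ j +ℕ m₂ +ℕ m₁
      j+[m₁+m₂]≡j+m₂+m₁ = P.trans (P.cong (j +ℕ_) (NP.+-comm m₁ m₂)) (P.sym (NP.+-assoc j m₂ m₁))

    -- In the corner argument with n - κ = 1 the rows of the corner minor must be lifted in order,
    -- row m by a factor L_{m+2}; the frontier counts how many of them a word can lift.
    advance : ℕ → ℕ → ℕ
    advance i m with i N.≟ suc (suc m)
    ... | yes _ = suc m
    ... | no  _ = m

    advance-≡ : ∀ {i m} → i ≡ suc (suc m) → advance i m ≡ suc m
    advance-≡ {i} {m} i≡m+2 with i N.≟ suc (suc m)
    ... | yes _     = P.refl
    ... | no  i≢m+2 = ⊥-elim (i≢m+2 i≡m+2)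

    advance-≢ : ∀ {i m} → i ≢ suc (suc m) → advance i m ≡ m
    advance-≢ {i} {m} i≢m+2 with i N.≟ suc (suc m)
    ... | yes i≡m+2 = ⊥-elim (i≢m+2 i≡m+2)
    ... | no  _     = P.refl

    m≤advance : ∀ i m → m ≤ advance i m
    m≤advance i m with i N.≟ suc (suc m)
    ... | yes _ = NP.n≤1+n m
    ... | no  _ = NP.≤-refl

    advance≤1+m : ∀ i m → advance i m ≤ suc m
    advance≤1+m i m with i N.≟ suc (suc m)
    ... | yes _ = NP.≤-refl
    ... | no  _ = NP.n≤1+n m

    advance-mono : ∀ i {m m′} → m ≤ m′ → advance i m ≤ advance i m′
    advance-mono i {m} {m′} m≤m′ with NP.m≤n⇒m<n∨m≡n m≤m′
    ... | inj₁ m<m′  = NP.≤-trans (advance≤1+m i m) (NP.≤-trans m<m′ (m≤advance i m′))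
    ... | inj₂ P.refl = NP.≤-refl

    frontier : Word → ℕ → ℕ
    frontier []            m = m
    frontier ((i , _) ∷ w) m = frontier w (advance i m)

    frontier-mono : ∀ w {m m′} → m ≤ m′ → frontier w m ≤ frontier w m′
    frontier-mono []            m≤m′ = m≤m′
    frontier-mono ((i , _) ∷ w) m≤m′ = frontier-mono w (advance-mono i m≤m′)

    frontier-++ : ∀ w₁ w₂ m → frontier (w₁ ++ w₂) m ≡ frontier w₂ (frontier w₁ m)
    frontier-++ []             w₂ m = P.refl
    frontier-++ ((i , _) ∷ w₁) w₂ m = frontier-++ w₁ w₂ (advance i m)

    frontier-descending-≡ : ∀ g j len m → j +ℕ len ≤ suc (suc m) → frontier (descending g j len) m ≡ m
    frontier-descending-≡ g j zero    m _  = P.refl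
    frontier-descending-≡ g j (suc l) m le = P.trans
      (P.cong (frontier (descending g j l)) (advance-≢ (NP.<⇒≢ j+l<m+2)))
      (frontier-descending-≡ g j l m (NP.<⇒≤ j+l<m+2))
      where
      j+l<m+2 : j +ℕ l < suc (suc m)
      j+l<m+2 = NP.<-≤-trans (NP.+-monoʳ-< j (NP.n<1+n l)) le

    -- the indices of a descending word decrease, so it moves at most one row
    frontier-descending≤ : ∀ g j len m → frontier (descending g j len) m ≤ suc m
    frontier-descending≤ g j zero    m = NP.n≤1+n m
    frontier-descending≤ g j (suc l) m with j +ℕ l N.≟ suc (suc m)
    ... | yes j+l≡m+2 =
          NP.≤-reflexive (frontier-descending-≡ g j l (suc m) (NP.≤-trans (NP.≤-reflexive j+l≡m+2) (NP.n≤1+n _)))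
    ... | no  _ = frontier-descending≤ g j l m

  module Minors (n κ : ℕ) (κ≤n : κ ≤ n) (1≤κ : 1 ≤ κ) where
    open Words n

    minor : Matrix n → (ℕ → ℕ) → Carrier
    minor M ρ = detRows κ (λ r k → entry M (ρ r) (toℕ k))

    minor-cong : ∀ {M M′} → M ≋ M′ → ∀ ρ → minor M ρ ≈ minor M′ ρ
    minor-cong M≋M′ ρ = det-cong κ (λ r k → entry-cong M≋M′ (ρ (toℕ r)) (toℕ k))

    column<n : ∀ (k : Fin κ) → toℕ k < n
    column<n k = NP.<-≤-trans (toℕ<n k) κ≤n

    κ∸1<κ : κ ∸ 1 < κ
    κ∸1<κ = NP.∸-monoʳ-< (s≤s z≤n) 1≤κ

    Increasing : (ℕ → ℕ) → Set
    Increasing ρ = ∀ r r′ → r < r′ → r′ < κ → ρ r < ρ r′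

    Increasing-injective : ∀ {ρ} → Increasing ρ → ∀ {r r′} → r < κ → r′ < κ → ρ r ≡ ρ r′ → r ≡ r′
    Increasing-injective inc {r} {r′} r<κ r′<κ ρr≡ρr′ with NP.<-cmp r r′
    ... | tri< r<r′ _ _ = ⊥-elim (NP.<-irrefl ρr≡ρr′ (inc r r′ r<r′ r′<κ))
    ... | tri≈ _ r≡r′ _ = r≡r′
    ... | tri> _ _ r′<r = ⊥-elim (NP.<-irrefl (P.sym ρr≡ρr′) (inc r′ r r′<r r<κ))

    Increasing⇒≤ : ∀ {ρ} → Increasing ρ → ∀ r → r < κ → r ≤ ρ r
    Increasing⇒≤ inc zero    _      = z≤n
    Increasing⇒≤ inc (suc r) 1+r<κ =
      NP.≤-<-trans (Increasing⇒≤ inc r (NP.<-trans (NP.n<1+n r) 1+r<κ)) (inc r (suc r) (NP.n<1+n r) 1+r<κ)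

    Increasing-identity : ∀ {ρ} → Increasing ρ → ρ (κ ∸ 1) < κ → ∀ r → r < κ → ρ r ≡ r
    Increasing-identity {ρ} inc top<κ r r<κ =
      NP.≤-antisym (below-top (κ ∸ suc r) r (NP.m+[n∸m]≡n r<κ)) (Increasing⇒≤ inc r r<κ)
      where
      below-top : ∀ d r → suc r +ℕ d ≡ κ → ρ r ≤ r
      below-top zero    r r+1+0≡κ = NP.<⇒≤pred (P.subst (λ t → ρ (t ∸ 1) < t) (P.sym r+1≡κ) top<κ)
        where
        r+1≡κ : suc r ≡ κ
        r+1≡κ = P.trans (P.sym (NP.+-identityʳ (suc r))) r+1+0≡κ
      below-top (suc d) r r+2+d≡κ = NP.<⇒≤pred (NP.<-≤-trans (inc r (suc r) (NP.n<1+n r) r+1<κ)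
                                      (below-top d (suc r) (P.trans (P.sym (NP.+-suc (suc r) d)) r+2+d≡κ)))
        where
        r+1<κ : suc r < κ
        r+1<κ = NP.<-≤-trans (s≤s (NP.m≤m+n (suc r) d))
                             (NP.≤-reflexive (P.trans (P.sym (NP.+-suc (suc r) d)) r+2+d≡κ))

    minor-L⊗-other : ∀ i q N ρ → (∀ r → r < κ → suc (ρ r) ≢ i) → minor (L i q ⊗ N) ρ ≈ minor N ρ
    minor-L⊗-other i q N ρ untouched =
      det-cong κ (λ r k → entry-L⊗-other i q N (ρ (toℕ r)) (toℕ k) (column<n k) (untouched (toℕ r) (toℕ<n r)))

    minor-L⊗-row : ∀ i q N ρ r₀ → 2 ≤ i → i ≤ n → r₀ < κ → suc (ρ r₀) ≡ i →
                   (∀ r → r < κ → r ≢ r₀ → ρ r ≢ ρ r₀) →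
                   minor (L i q ⊗ N) ρ ≈ minor N ρ + q * minor N (replaceAt ρ r₀ (i ∸ 2))
    minor-L⊗-row i q N ρ r₀ 2≤i i≤n r₀<κ ρr₀+1≡i distinct =
      detRows-linear κ (λ r k → entry (L i q ⊗ N) (ρ r) (toℕ k)) (λ r k → entry N (ρ r) (toℕ k))
        (λ r k → entry N (replaceAt ρ r₀ (i ∸ 2) r) (toℕ k)) q r₀ r₀<κ
        (λ r r<κ r≢r₀ k → entry-L⊗-other i q N (ρ r) (toℕ k) (column<n k)
           (λ e → distinct r r<κ r≢r₀ (NP.suc-injective (P.trans e (P.sym ρr₀+1≡i)))))
        (λ r r<κ r≢r₀ k → reflexive (P.cong (λ t → entry N t (toℕ k)) (replaceAt-≢ ρ r₀ (i ∸ 2) r≢r₀)))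
        (λ k → trans (entry-L⊗-row i q N (ρ r₀) (toℕ k) (column<n k) 2≤i i≤n ρr₀+1≡i)
           (+-cong refl (*-cong refl (reflexive (P.cong (λ t → entry N t (toℕ k)) (P.sym (replaceAt-≡ ρ r₀ (i ∸ 2))))))))

    minor-repeated-row : ∀ X ρ r x → suc r < κ → ρ r ≡ x → minor X (replaceAt ρ (suc r) x) ≈ 0#
    minor-repeated-row X ρ r x r+1<κ ρr≡x =
      detRows-equal-adjacent κ (λ r′ k → entry X (replaceAt ρ (suc r) x r′) (toℕ k)) r r+1<κ (λ k → reflexive
      (P.cong (λ t → entry X t (toℕ k))
        (P.trans (replaceAt-≢ ρ (suc r) x (NP.1+n≢n ∘ P.sym)) (P.trans ρr≡x (P.sym (replaceAt-≡ ρ (suc r) x))))))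

    Increasing-adjacent : ∀ {ρ} → Increasing ρ → ∀ {r₀ r₁} → r₀ < κ → r₁ < κ → suc (ρ r₁) ≡ ρ r₀ →
                          r₀ ≡ suc r₁
    Increasing-adjacent {ρ} inc {r₀} {r₁} r₀<κ r₁<κ ρr₁+1≡ρr₀ with NP.<-cmp r₁ r₀
    ... | tri≈ _ r₁≡r₀ _ = ⊥-elim (NP.1+n≢n (P.trans ρr₁+1≡ρr₀ (P.cong ρ (P.sym r₁≡r₀))))
    ... | tri> _ _ r₀<r₁ =
          ⊥-elim (NP.<-irrefl (P.sym ρr₁+1≡ρr₀) (NP.<-trans (inc r₀ r₁ r₀<r₁ r₁<κ) (NP.n<1+n _)))
    ... | tri< r₁<r₀ _ _ with NP.m≤n⇒m<n∨m≡n r₁<r₀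
    ...   | inj₂ r₁+1≡r₀ = P.sym r₁+1≡r₀
    ...   | inj₁ r₁+1<r₀ = ⊥-elim (NP.<-irrefl ρr₁+1≡ρr₀
            (NP.≤-<-trans (inc r₁ (suc r₁) (NP.n<1+n r₁) (NP.<-trans r₁+1<r₀ r₀<κ))
                          (inc (suc r₁) r₀ r₁+1<r₀ r₀<κ)))

    Increasing-replaceAt : ∀ {ρ} → Increasing ρ → ∀ r₀ x → suc x ≡ ρ r₀ → (∀ r → r < κ → ρ r ≢ x) →
                           Increasing (replaceAt ρ r₀ x)
    Increasing-replaceAt {ρ} inc r₀ x x+1≡ρr₀ free r r′ r<r′ r′<κ
      with replaceAt-cases ρ r₀ x r | replaceAt-cases ρ r₀ x r′
    ... | inj₁ (r≡r₀ , _) | inj₁ (r′≡r₀ , _) = ⊥-elim (NP.<-irrefl (P.trans r≡r₀ (P.sym r′≡r₀)) r<r′)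
    ... | inj₁ (P.refl , e) | inj₂ (_ , e′) rewrite e | e′ =
          NP.<-≤-trans (NP.≤-reflexive x+1≡ρr₀) (NP.<⇒≤ (inc r r′ r<r′ r′<κ))
    ... | inj₂ (_ , e) | inj₁ (P.refl , e′) rewrite e | e′ =
          NP.≤∧≢⇒< (NP.<⇒≤pred (P.subst (ρ r <_) (P.sym x+1≡ρr₀) (inc r r′ r<r′ r′<κ)))
                   (free r (NP.<-trans r<r′ r′<κ))
    ... | inj₂ (_ , e) | inj₂ (_ , e′) rewrite e | e′ = inc r r′ r<r′ r′<κ

    -- L_i(q) adds q times row i - 2 to row i - 1 (counting from 0); this lifts row r₀ of the
    -- minor unless another row of the minor already sits at i - 2.
    LegalMove : ℕ → (ℕ → ℕ) → ℕ → Set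
    LegalMove i ρ r₀ = r₀ < κ × suc (ρ r₀) ≡ i × (∀ r → r < κ → ρ r ≢ i ∸ 2)

    -- Climbs w ρ: the factors of w, read from left to right, move the rows ρ to 0, …, κ - 1;
    -- in the language of planar networks, a family of non-intersecting paths.
    data Climbs : Word → (ℕ → ℕ) → Set c where
      done : ∀ {ρ} → (∀ r → r < κ → ρ r ≡ r) → Climbs [] ρ
      skip : ∀ {i q w ρ} → Climbs w ρ → Climbs ((i , q) ∷ w) ρ
      move : ∀ {i q w ρ} r₀ → LegalMove i ρ r₀ → Climbs w (replaceAt ρ r₀ (i ∸ 2)) → Climbs ((i , q) ∷ w) ρ

    data LetterStep (i : ℕ) (q : Carrier) (X : Matrix n) (ρ : ℕ → ℕ) : Set ℓ₁ where
      stays : minor (L i q ⊗ X) ρ ≈ minor X ρ → (∀ r₀ → ¬ LegalMove i ρ r₀) → LetterStep i q X ρ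
      moves : ∀ r₀ → LegalMove i ρ r₀ → Increasing (replaceAt ρ r₀ (i ∸ 2)) →
              minor (L i q ⊗ X) ρ ≈ minor X ρ + q * minor X (replaceAt ρ r₀ (i ∸ 2)) → LetterStep i q X ρ

    letterStep : ∀ i q X ρ → 2 ≤ i → i ≤ n → Increasing ρ → LetterStep i q X ρ
    letterStep i q X ρ 2≤i i≤n inc with NP.anyUpTo? (λ r → suc (ρ r) N.≟ i) κ
    ... | no untouched = stays (minor-L⊗-other i q X ρ (λ r r<κ e → untouched (r , r<κ , e)))
                               (λ { r₀ (r₀<κ , e , _) → untouched (r₀ , r₀<κ , e) })
    ... | yes (r₀ , r₀<κ , ρr₀+1≡i) = touched (NP.anyUpTo? (λ r → ρ r N.≟ i ∸ 2) κ)
      where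
      i∸2+1≡ρr₀ : suc (i ∸ 2) ≡ ρ r₀
      i∸2+1≡ρr₀ = NP.suc-injective (P.trans (2+[i∸2]≡i 2≤i) (P.sym ρr₀+1≡i))
      expansion : minor (L i q ⊗ X) ρ ≈ minor X ρ + q * minor X (replaceAt ρ r₀ (i ∸ 2))
      expansion = minor-L⊗-row i q X ρ r₀ 2≤i i≤n r₀<κ ρr₀+1≡i
                    (λ r r<κ r≢r₀ → r≢r₀ ∘ Increasing-injective inc r<κ r₀<κ)
      touched : Dec (∃ λ r → r < κ × ρ r ≡ i ∸ 2) → LetterStep i q X ρ
      touched (yes (r₁ , r₁<κ , ρr₁≡i∸2)) =
        stays (trans expansion (trans (+-cong refl (trans (*-cong refl collision) (zeroʳ q))) (+-identityʳ _)))
              (λ { _ (_ , _ , free) → free r₁ r₁<κ ρr₁≡i∸2 })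
        where
        r₀≡r₁+1 : r₀ ≡ suc r₁
        r₀≡r₁+1 = Increasing-adjacent inc r₀<κ r₁<κ (P.trans (P.cong suc ρr₁≡i∸2) i∸2+1≡ρr₀)
        collision : minor X (replaceAt ρ r₀ (i ∸ 2)) ≈ 0#
        collision rewrite r₀≡r₁+1 = minor-repeated-row X ρ r₁ (i ∸ 2) (P.subst (_< κ) r₀≡r₁+1 r₀<κ) ρr₁≡i∸2
      touched (no occupied) =
        moves r₀ (r₀<κ , ρr₀+1≡i , free) (Increasing-replaceAt inc r₀ (i ∸ 2) i∸2+1≡ρr₀ free) expansion
        where
        free : ∀ r → r < κ → ρ r ≢ i ∸ 2
        free r r<κ e = occupied (r , r<κ , e)

    entry-I : ∀ p k → k < n → entry (I {n}) p k ≈ δ p k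
    entry-I p k k<n with p <? n
    ... | yes p<n = reflexive (P.trans (entry-fromℕ< I p k p<n k<n) (P.cong₂ δ (toℕ-fromℕ< p<n) (toℕ-fromℕ< k<n)))
    ... | no  p≮n = reflexive (P.trans (entry-≥ I p k (NP.≮⇒≥ p≮n))
                                       (P.sym (δ-≢ p k (λ p≡k → p≮n (P.subst (_< n) (P.sym p≡k) k<n)))))

    minor-I : ∀ {ρ} → Increasing ρ →
              (Climbs [] ρ × minor (I {n}) ρ ≈ 1#) ⊎ (¬ Climbs [] ρ × minor (I {n}) ρ ≈ 0#)
    minor-I {ρ} inc with ρ (κ ∸ 1) <? κ
    ... | yes top<κ = inj₁ (done ids , trans (det-cong κ (λ r k → trans (entry-I (ρ (toℕ r)) (toℕ k) (column<n k))
                                               (reflexive (P.cong (λ t → δ t (toℕ k)) (ids (toℕ r) (toℕ<n r))))))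
                                             (detRows-δ κ))
      where
      ids : ∀ r → r < κ → ρ r ≡ r
      ids = Increasing-identity inc top<κ
    ... | no  top≮κ = inj₂ ((λ { (done ids) → top≮κ (P.subst (_< κ) (P.sym (ids (κ ∸ 1) κ∸1<κ)) κ∸1<κ) }) ,
                           detRows-zero-row κ (λ r k → entry (I {n}) (ρ r) (toℕ k)) (κ ∸ 1) κ∸1<κ (λ k →
                             trans (entry-I (ρ (κ ∸ 1)) (toℕ k) (column<n k))
                                   (reflexive (δ-≢ _ _ (λ e → top≮κ (P.subst (_< κ) (P.sym e) (toℕ<n k)))))))

    minor-nonneg : ∀ w ρ → PositiveWord w → Increasing ρ → NonNegative (minor (evalWord w I) ρ)
    minor-nonneg [] ρ _ inc with minor-I inc
    ... | inj₁ (_ , minor≈1) = inj₂ (<-respʳ (sym minor≈1) 0<1)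
    ... | inj₂ (_ , minor≈0) = inj₁ minor≈0
    minor-nonneg ((i , q) ∷ w) ρ ((2≤i , i≤n , 0<q) ∷ pos) inc with letterStep i q (evalWord w I) ρ 2≤i i≤n inc
    ... | stays eq _         = NonNegative-resp (sym eq) (minor-nonneg w ρ pos inc)
    ... | moves r₀ _ inc′ eq = NonNegative-resp (sym eq)
            (nonneg+nonneg (minor-nonneg w ρ pos inc) (pos*nonneg 0<q (minor-nonneg w _ pos inc′)))

    minor-pos : ∀ w ρ → PositiveWord w → Increasing ρ → Climbs w ρ → 0# <F minor (evalWord w I) ρ
    minor-pos [] ρ _ inc climbs with minor-I inc
    ... | inj₁ (_ , minor≈1)  = <-respʳ (sym minor≈1) 0<1
    ... | inj₂ (¬climbs , _) = ⊥-elim (¬climbs climbs)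
    minor-pos ((i , q) ∷ w) ρ ((2≤i , i≤n , 0<q) ∷ pos) inc climbs
      with letterStep i q (evalWord w I) ρ 2≤i i≤n inc | climbs
    ... | stays eq _          | skip climbs′     = <-respʳ (sym eq) (minor-pos w ρ pos inc climbs′)
    ... | stays _ immobile    | move r₀ legal _ = ⊥-elim (immobile r₀ legal)
    ... | moves _ _ inc′ eq   | skip climbs′     = <-respʳ (sym eq)
            (pos+nonneg (minor-pos w ρ pos inc climbs′) (pos*nonneg 0<q (minor-nonneg w _ pos inc′)))
    ... | moves r₀ (r₀<κ , ρr₀+1≡i , _) inc′ eq | move r₀′ (r₀′<κ , ρr₀′+1≡i , _) climbs′ =
          <-respʳ (sym eq)
            (nonneg+pos (minor-nonneg w ρ pos inc) (*-pos 0<q (minor-pos w _ pos inc′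
              (P.subst (λ t → Climbs w (replaceAt ρ t (i ∸ 2))) r₀′≡r₀ climbs′))))
      where
      r₀′≡r₀ : r₀′ ≡ r₀
      r₀′≡r₀ = Increasing-injective inc r₀′<κ r₀<κ (NP.suc-injective (P.trans ρr₀′+1≡i (P.sym ρr₀+1≡i)))

    minor-zero : ∀ w ρ → PositiveWord w → Increasing ρ → ¬ Climbs w ρ → minor (evalWord w I) ρ ≈ 0#
    minor-zero [] ρ _ inc ¬climbs with minor-I inc
    ... | inj₁ (climbs , _)  = ⊥-elim (¬climbs climbs)
    ... | inj₂ (_ , minor≈0) = minor≈0
    minor-zero ((i , q) ∷ w) ρ ((2≤i , i≤n , _) ∷ pos) inc ¬climbs with letterStep i q (evalWord w I) ρ 2≤i i≤n inc
    ... | stays eq _ = trans eq (minor-zero w ρ pos inc (¬climbs ∘ skip))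
    ... | moves r₀ legal inc′ eq = trans eq (trans
            (+-cong (minor-zero w ρ pos inc (¬climbs ∘ skip))
                    (*-cong refl (minor-zero w _ pos inc′ (¬climbs ∘ move r₀ legal))))
            (trans (+-identityˡ _) (zeroʳ q)))

    Climbs-resp : ∀ w {ρ ρ′} → (∀ r → r < κ → ρ r ≡ ρ′ r) → Climbs w ρ → Climbs w ρ′
    Climbs-resp [] ρ≗ρ′ (done ids) = done (λ r r<κ → P.trans (P.sym (ρ≗ρ′ r r<κ)) (ids r r<κ))
    Climbs-resp ((i , q) ∷ w) ρ≗ρ′ (skip climbs) = skip (Climbs-resp w ρ≗ρ′ climbs)
    Climbs-resp ((i , q) ∷ w) {ρ} {ρ′} ρ≗ρ′ (move r₀ (r₀<κ , ρr₀+1≡i , free) climbs) =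
      move r₀ (r₀<κ , P.trans (P.cong suc (P.sym (ρ≗ρ′ r₀ r₀<κ))) ρr₀+1≡i ,
               (λ r r<κ → free r r<κ ∘ P.trans (ρ≗ρ′ r r<κ)))
        (Climbs-resp w replaced climbs)
      where
      replaced : ∀ r → r < κ → replaceAt ρ r₀ (i ∸ 2) r ≡ replaceAt ρ′ r₀ (i ∸ 2) r
      replaced r r<κ with replaceAt-cases ρ r₀ (i ∸ 2) r | replaceAt-cases ρ′ r₀ (i ∸ 2) r
      ... | inj₁ (_ , e) | inj₁ (_ , e′) = P.trans e (P.sym e′)
      ... | inj₁ (r≡r₀ , _) | inj₂ (r≢r₀ , _) = ⊥-elim (r≢r₀ r≡r₀)
      ... | inj₂ (r≢r₀ , _) | inj₁ (r≡r₀ , _) = ⊥-elim (r≢r₀ r≡r₀)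
      ... | inj₂ (_ , e) | inj₂ (_ , e′) = P.trans e (P.trans (ρ≗ρ′ r r<κ) (P.sym e′))

    Climbs-++ˡ : ∀ w {rest ρ} → Climbs rest ρ → Climbs (w ++ rest) ρ
    Climbs-++ˡ []      climbs = climbs
    Climbs-++ˡ (_ ∷ w) climbs = skip (Climbs-++ˡ w climbs)

  module Corners (n κ : ℕ) (κ≤n : κ ≤ n) (1≤κ : 1 ≤ κ) where
    open Words n
    open Minors n κ κ≤n 1≤κ

    D : ℕ
    D = n ∸ κ

    -- Rows r < k of the minor have reached row r; the others are still in the lower-left
    -- corner, at row (n - κ) + r.  corner 0 gives the lower-left corner minor itself.
    corner : ℕ → ℕ → ℕ
    corner k r with r <? k
    ... | yes _ = r
    ... | no  _ = D +ℕ r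

    corner-< : ∀ {k r} → r < k → corner k r ≡ r
    corner-< {k} {r} r<k with r <? k
    ... | yes _   = P.refl
    ... | no  r≮k = ⊥-elim (r≮k r<k)

    corner-≥ : ∀ {k r} → k ≤ r → corner k r ≡ D +ℕ r
    corner-≥ {k} {r} k≤r with r <? k
    ... | yes r<k = ⊥-elim (NP.<⇒≱ r<k k≤r)
    ... | no  _   = P.refl

    corner-suc : ∀ {k r} → r ≢ k → corner (suc k) r ≡ corner k r
    corner-suc {k} {r} r≢k with NP.<-cmp r k
    ... | tri< r<k _ _ = P.trans (corner-< (NP.m<n⇒m<1+n r<k)) (P.sym (corner-< r<k))
    ... | tri≈ _ r≡k _ = ⊥-elim (r≢k r≡k)
    ... | tri> _ _ k<r = P.trans (corner-≥ k<r) (P.sym (corner-≥ (NP.<⇒≤ k<r)))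

    corner-replaceAt : ∀ k r → corner k r ≡ replaceAt (corner (suc k)) k (D +ℕ k) r
    corner-replaceAt k r with replaceAt-cases (corner (suc k)) k (D +ℕ k) r
    ... | inj₁ (P.refl , e) = P.trans (corner-≥ NP.≤-refl) (P.sym e)
    ... | inj₂ (r≢k , e)    = P.trans (P.sym (corner-suc r≢k)) (P.sym e)

    climb-row : ∀ g k e rest → k < κ → e ≤ D → Climbs rest (corner (suc k)) →
                Climbs (descending g (suc (suc k)) e ++ rest) (replaceAt (corner (suc k)) k (k +ℕ e))
    climb-row g k zero rest k<κ _ climbs = Climbs-resp rest (λ r _ → P.sym (replaceAt-self (corner (suc k)) k (k +ℕ 0)
      (P.trans (corner-< (NP.n<1+n k)) (P.sym (NP.+-identityʳ k))) r)) climbs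
    climb-row g k (suc e) rest k<κ e<D climbs =
      move k (k<κ , at-row , free) (Climbs-resp (descending g (suc (suc k)) e ++ rest)
        (λ r _ → P.sym (replaceAt-replaceAt (corner (suc k)) k (k +ℕ suc e) (k +ℕ e) r))
        (climb-row g k e rest k<κ (NP.<⇒≤ e<D) climbs))
      where
      ρ = replaceAt (corner (suc k)) k (k +ℕ suc e)
      at-row : suc (ρ k) ≡ suc (suc k) +ℕ e
      at-row = P.cong suc (P.trans (replaceAt-≡ (corner (suc k)) k (k +ℕ suc e)) (NP.+-suc k e))
      free : ∀ r → r < κ → ρ r ≢ k +ℕ e
      free r _ ρr≡k+e with replaceAt-cases (corner (suc k)) k (k +ℕ suc e) r
      ... | inj₁ (_ , ρr≡k+1+e) = NP.1+n≢n (P.trans (P.trans (P.sym (NP.+-suc k e)) (P.sym ρr≡k+1+e)) ρr≡k+e)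
      ... | inj₂ (r≢k , ρr≡) with NP.<-cmp r k
      ...   | tri< r<k _ _ = NP.<-irrefl (P.trans (P.sym (P.trans ρr≡ (corner-< (NP.m<n⇒m<1+n r<k)))) ρr≡k+e)
                               (NP.<-≤-trans r<k (NP.m≤m+n k e))
      ...   | tri≈ _ r≡k _ = r≢k r≡k
      ...   | tri> _ _ k<r = NP.<-irrefl (P.trans (P.sym ρr≡k+e) (P.trans ρr≡ (corner-≥ k<r)))
                               (NP.<-≤-trans (NP.+-monoʳ-< k e<D) (NP.≤-trans (NP.≤-reflexive (NP.+-comm k D))
                                 (NP.+-monoʳ-≤ D (NP.<⇒≤ k<r))))

    climb-descending : ∀ g i len k rest → k < κ → i ≤ suc (suc k) → suc (suc k) +ℕ D ≤ i +ℕ len →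
                       Climbs rest (corner (suc k)) → Climbs (descending g i len ++ rest) (corner k)
    climb-descending g i len k rest k<κ i≤k+2 k+2+D≤i+len climbs =
      P.subst (λ w → Climbs w (corner k)) split
        (Climbs-++ˡ (descending g (i +ℕ (D +ℕ below)) above)
          (Climbs-resp (descending g (suc (suc k)) D ++ (descending g i below ++ rest)) row-k-climbed
            (climb-row g k D (descending g i below ++ rest) k<κ NP.≤-refl (Climbs-++ˡ (descending g i below) climbs))))
      where
      below above : ℕ
      below = suc (suc k) ∸ i
      above = len ∸ (D +ℕ below)
      i+below≡k+2 : i +ℕ below ≡ suc (suc k)
      i+below≡k+2 = NP.m+[n∸m]≡n i≤k+2
      i+[D+below]≡k+2+D : i +ℕ (D +ℕ below) ≡ suc (suc k) +ℕ D
      i+[D+below]≡k+2+D = P.trans (NP.+-comm i (D +ℕ below)) (P.trans (NP.+-assoc D below i)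
        (P.trans (P.cong (D +ℕ_) (P.trans (NP.+-comm below i) i+below≡k+2)) (NP.+-comm D (suc (suc k)))))
      len≡ : above +ℕ (D +ℕ below) ≡ len
      len≡ = NP.m∸n+n≡m (NP.+-cancelˡ-≤ i (D +ℕ below) len
               (P.subst (_≤ i +ℕ len) (P.sym i+[D+below]≡k+2+D) k+2+D≤i+len))
      row-k-climbed : ∀ r → r < κ → replaceAt (corner (suc k)) k (k +ℕ D) r ≡ corner k r
      row-k-climbed r _ = P.trans (P.cong (λ t → replaceAt (corner (suc k)) k t r) (NP.+-comm k D))
                                  (P.sym (corner-replaceAt k r))
      split : descending g (i +ℕ (D +ℕ below)) above ++ (descending g (suc (suc k)) D ++ (descending g i below ++ rest))
              ≡ descending g i len ++ rest
      split = P.trans (P.cong (descending g (i +ℕ (D +ℕ below)) above ++_)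
                 (P.trans (P.cong (λ t → descending g t D ++ (descending g i below ++ rest)) (P.sym i+below≡k+2))
                   (P.trans (P.sym (ListP.++-assoc (descending g (i +ℕ below) D) _ rest))
                     (P.cong (_++ rest) (P.sym (descending-+ g i D below))))))
              (P.trans (P.sym (ListP.++-assoc (descending g (i +ℕ (D +ℕ below)) above) _ rest))
                (P.cong (_++ rest) (P.trans (P.sym (descending-+ g i above (D +ℕ below))) (P.cong (descending g i) len≡))))

    Increasing-corner-zero : Increasing (corner 0)
    Increasing-corner-zero r r′ r<r′ _ =
      P.subst₂ _<_ (P.sym (corner-≥ z≤n)) (P.sym (corner-≥ z≤n)) (NP.+-monoʳ-< D r<r′)

    cornerMinor≈minor : ∀ M → cornerMinor M κ κ≤n ≈ minor M (corner 0)
    cornerMinor≈minor M = det-cong κ (λ r k → reflexive (P.trans (P.sym (entry-toℕ M _ _))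
      (P.cong₂ (entry M) (P.trans (toℕ-cast _ (D ↑ʳ r)) (P.trans (toℕ-↑ʳ D r) (P.sym (corner-≥ z≤n))))
                         (toℕ-inject≤ k κ≤n))))

    module _ (D≡1 : D ≡ 1) where

      corner-self : ∀ m → corner m m ≡ suc m
      corner-self m = P.trans (corner-≥ NP.≤-refl) (P.cong (_+ℕ m) D≡1)

      corner-pred : ∀ {m r} → r ≢ m → corner m (r ∸ 1) ≡ corner m r ∸ 1
      corner-pred {m} {r} r≢m with NP.<-cmp r m
      ... | tri< r<m _ _ = P.trans (corner-< (NP.≤-<-trans (NP.m∸n≤m r 1) r<m)) (P.cong (_∸ 1) (P.sym (corner-< r<m)))
      ... | tri≈ _ r≡m _ = ⊥-elim (r≢m r≡m)
      ... | tri> _ _ m<r = above m<r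
        where
        above : ∀ {r} → m < r → corner m (r ∸ 1) ≡ corner m r ∸ 1
        above {suc r} (s≤s m≤r) = P.trans (P.trans (corner-≥ m≤r) (P.cong (_+ℕ r) D≡1))
          (P.cong (_∸ 1) (P.sym (P.trans (corner-≥ (NP.m≤n⇒m≤1+n m≤r)) (P.cong (_+ℕ suc r) D≡1))))

      corner-legal : ∀ {i r₀} m → LegalMove i (corner m) r₀ → r₀ ≡ m
      corner-legal {i} {r₀} m (r₀<κ , at-row , free) with r₀ N.≟ m
      ... | yes r₀≡m = r₀≡m
      ... | no  r₀≢m = ⊥-elim (free (r₀ ∸ 1) (NP.≤-<-trans (NP.m∸n≤m r₀ 1) r₀<κ)
                                   (P.trans (corner-pred r₀≢m) (P.cong (_∸ 2) at-row)))

      corner-frontier : ∀ w m → Climbs w (corner m) → κ ≤ frontier w m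
      corner-frontier [] m (done ids) with m <? κ
      ... | yes m<κ = ⊥-elim (NP.1+n≢n (P.trans (P.sym (corner-self m)) (ids m m<κ)))
      ... | no  m≮κ = NP.≮⇒≥ m≮κ
      corner-frontier ((i , q) ∷ w) m (skip climbs) =
        NP.≤-trans (corner-frontier w m climbs) (frontier-mono w (m≤advance i m))
      corner-frontier ((i , q) ∷ w) m (move r₀ legal climbs) with corner-legal m legal
      ... | P.refl = P.subst (λ t → κ ≤ frontier w t) (P.sym (advance-≡ i≡m+2))
                       (corner-frontier w (suc m) (Climbs-resp w moved climbs))
        where
        i≡m+2 : i ≡ suc (suc m)
        i≡m+2 = P.trans (P.sym (proj₁ (proj₂ legal))) (P.cong suc (corner-self m))
        moved : ∀ r → r < κ → replaceAt (corner m) m (i ∸ 2) r ≡ corner (suc m) r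
        moved r _ with replaceAt-cases (corner m) m (i ∸ 2) r
        ... | inj₁ (P.refl , e) = P.trans e (P.trans (P.cong (_∸ 2) i≡m+2) (P.sym (corner-< (NP.n<1+n r))))
        ... | inj₂ (r≢m , e)    = P.trans e (P.sym (corner-suc r≢m))

  module Factorisation (n s : ℕ) (a : ℕ → ℕ → Carrier) where
    open Words n

    wordW : ℕ → Word
    wordW i = descending (a i) i (suc n ∸ i)

    wordWs : ℕ → ℕ → Word
    wordWs zero    i = []
    wordWs (suc m) i = wordW i ++ wordWs m (suc i)

    wordA : Word
    wordA = wordWs (s ∸ 1) 2

    wordA^ : ℕ → Word
    wordA^ zero    = []
    wordA^ (suc w) = wordA ++ wordA^ w

    descending-suc : ∀ g j m → descending g (suc j) m ++ (j , g j) ∷ [] ≡ descending g j (suc m)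
    descending-suc g j zero    = P.cong (λ t → (t , g t) ∷ []) (P.sym (NP.+-identityʳ j))
    descending-suc g j (suc m) = P.cong₂ _∷_ (P.cong (λ t → (t , g t)) (P.sym (NP.+-suc j m))) (descending-suc g j m)

    Wseg-⊗ : ∀ i m j N → Wseg n a i m j ⊗ N ≋ evalWord (descending (a i) j m) N
    Wseg-⊗ i zero    j N = ⊗-identityˡ N
    Wseg-⊗ i (suc m) j N =
      ≋-trans (⊗-assoc (Wseg n a i m (suc j)) (L j (a i j)) N)
        (≋-trans (Wseg-⊗ i m (suc j) (L j (a i j) ⊗ N))
          (≋-reflexive (P.trans (P.sym (evalWord-++ (descending (a i) (suc j) m) ((j , a i j) ∷ []) N))
                                (P.cong (λ w → evalWord w N) (descending-suc (a i) j m)))))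

    Aseg-⊗ : ∀ m i N → Aseg n a m i ⊗ N ≋ evalWord (wordWs m i) N
    Aseg-⊗ zero    i N = ⊗-identityˡ N
    Aseg-⊗ (suc m) i N =
      ≋-trans (⊗-assoc (W n a i) (Aseg n a m (suc i)) N)
        (≋-trans (⊗-cong ≋-refl (Aseg-⊗ m (suc i) N))
          (≋-trans (Wseg-⊗ i (suc n ∸ i) i (evalWord (wordWs m (suc i)) N))
            (≋-reflexive (P.sym (evalWord-++ (wordW i) (wordWs m (suc i)) N)))))

    A^-evalWord : ∀ w → Amat n s a ^M w ≋ evalWord (wordA^ w) I
    A^-evalWord zero    = ≋-refl
    A^-evalWord (suc w) =
      ≋-trans (⊗-cong ≋-refl (A^-evalWord w))
        (≋-trans (Aseg-⊗ (s ∸ 1) 2 (evalWord (wordA^ w) I)) (≋-reflexive (P.sym (evalWord-++ wordA (wordA^ w) I))))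

    frontier-wordWs : ∀ k i m → frontier (wordWs k i) m ≤ m +ℕ k
    frontier-wordWs zero    i m = NP.≤-reflexive (P.sym (NP.+-identityʳ m))
    frontier-wordWs (suc k) i m = P.subst (_≤ m +ℕ suc k) (P.sym (frontier-++ (wordW i) (wordWs k (suc i)) m))
      (NP.≤-trans (frontier-mono (wordWs k (suc i)) (frontier-descending≤ (a i) i (suc n ∸ i) m))
        (NP.≤-trans (frontier-wordWs k (suc i) (suc m)) (NP.≤-reflexive (P.sym (NP.+-suc m k)))))

    frontier-wordA^ : ∀ w m → frontier (wordA^ w) m ≤ m +ℕ w *ℕ (s ∸ 1)
    frontier-wordA^ zero    m = NP.≤-reflexive (P.sym (NP.+-identityʳ m))
    frontier-wordA^ (suc w) m = P.subst (_≤ m +ℕ suc w *ℕ (s ∸ 1)) (P.sym (frontier-++ wordA (wordA^ w) m))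
      (NP.≤-trans (frontier-mono (wordA^ w) (frontier-wordWs (s ∸ 1) 2 m))
        (NP.≤-trans (frontier-wordA^ w (m +ℕ (s ∸ 1))) (NP.≤-reflexive (NP.+-assoc m (s ∸ 1) (w *ℕ (s ∸ 1))))))

    module Climbing (s≤n : s ≤ n) (1≤s : 1 ≤ s) (κ : ℕ) (κ≤n : κ ≤ n) (1≤κ : 1 ≤ κ) where
      open Minors n κ κ≤n 1≤κ
      open Corners n κ κ≤n 1≤κ

      climb-wordW : ∀ i k rest → i ≤ s → i ≤ suc (suc k) → Climbs rest (corner (suc k)) →
                    Climbs (wordW i ++ rest) (corner k)
      climb-wordW i k rest i≤s i≤k+2 climbs with k <? κ
      ... | yes k<κ = climb-descending (a i) i (suc n ∸ i) k rest k<κ i≤k+2 k+2+D≤n+1 climbs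
        where
        k+2+D≤n+1 : suc (suc k) +ℕ D ≤ i +ℕ (suc n ∸ i)
        k+2+D≤n+1 = P.subst (suc (suc k) +ℕ D ≤_)
                      (P.sym (NP.m+[n∸m]≡n (NP.≤-trans i≤s (NP.≤-trans s≤n (NP.n≤1+n n)))))
                      (s≤s (NP.≤-trans (NP.+-monoˡ-≤ D k<κ) (NP.≤-reflexive (NP.m+[n∸m]≡n κ≤n))))
      ... | no  k≮κ = Climbs-++ˡ (wordW i) (Climbs-resp rest (λ r r<κ →
                        P.trans (corner-< (NP.<-≤-trans r<κ (NP.m≤n⇒m≤1+n (NP.≮⇒≥ k≮κ))))
                                (P.sym (corner-< (NP.<-≤-trans r<κ (NP.≮⇒≥ k≮κ))))) climbs)

      -- W_{i+t} lifts row k + t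
      climb-wordWs : ∀ m i k rest → i +ℕ m ≤ suc s → i ≤ suc (suc k) → Climbs rest (corner (k +ℕ m)) →
                     Climbs (wordWs m i ++ rest) (corner k)
      climb-wordWs zero    i k rest _  _     climbs =
        Climbs-resp rest (λ r _ → P.cong (λ t → corner t r) (NP.+-identityʳ k)) climbs
      climb-wordWs (suc m) i k rest le i≤k+2 climbs =
        P.subst (λ w → Climbs w (corner k)) (P.sym (ListP.++-assoc (wordW i) (wordWs m (suc i)) rest))
          (climb-wordW i k (wordWs m (suc i) ++ rest) i≤s i≤k+2
            (climb-wordWs m (suc i) (suc k) rest i+1+m≤1+s (s≤s i≤k+2)
              (P.subst (λ t → Climbs rest (corner t)) (NP.+-suc k m) climbs)))
        where
        i+1+m≤1+s : suc i +ℕ m ≤ suc s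
        i+1+m≤1+s = P.subst (_≤ suc s) (NP.+-suc i m) le
        i≤s : i ≤ s
        i≤s = NP.≤-pred (NP.≤-trans (s≤s (NP.m≤m+n i m)) i+1+m≤1+s)

      climb-wordA^ : ∀ w k → κ ≤ k +ℕ w *ℕ (s ∸ 1) → Climbs (wordA^ w) (corner k)
      climb-wordA^ zero    k κ≤k =
        done (λ r r<κ → corner-< (NP.<-≤-trans r<κ (P.subst (κ ≤_) (NP.+-identityʳ k) κ≤k)))
      climb-wordA^ (suc w) k le  = climb-wordWs (s ∸ 1) 2 k (wordA^ w) (2+[m∸1]≤1+m 1≤s) (s≤s (s≤s z≤n))
        (climb-wordA^ w (k +ℕ (s ∸ 1)) (P.subst (κ ≤_) (P.sym (NP.+-assoc k (s ∸ 1) (w *ℕ (s ∸ 1)))) le))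

    module PowersOfA (apos : ∀ i j → 2 ≤ i → i ≤ s → i ≤ j → j ≤ n → 0# <F a i j)
                  (s≤n : s ≤ n) (1≤s : 1 ≤ s) where

      positive-descending : ∀ i j m → 2 ≤ i → i ≤ s → i ≤ j → j +ℕ m ≤ suc n →
                            PositiveWord (descending (a i) j m)
      positive-descending i j zero    _   _   _   _  = []
      positive-descending i j (suc m) 2≤i i≤s i≤j le =
        (NP.≤-trans 2≤i i≤j+m , j+m≤n , apos i (j +ℕ m) 2≤i i≤s i≤j+m j+m≤n) ∷
        positive-descending i j m 2≤i i≤s i≤j (NP.≤-trans (NP.+-monoʳ-≤ j (NP.n≤1+n m)) le)
        where
        i≤j+m : i ≤ j +ℕ m
        i≤j+m = NP.≤-trans i≤j (NP.m≤m+n j m)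
        j+m≤n : j +ℕ m ≤ n
        j+m≤n = NP.≤-pred (P.subst (_≤ suc n) (NP.+-suc j m) le)

      positive-wordWs : ∀ m i → 2 ≤ i → i +ℕ m ≤ suc s → PositiveWord (wordWs m i)
      positive-wordWs zero    i _   _  = []
      positive-wordWs (suc m) i 2≤i le = ++⁺
        (positive-descending i i (suc n ∸ i) 2≤i i≤s NP.≤-refl
          (NP.≤-reflexive (NP.m+[n∸m]≡n (NP.≤-trans i≤s (NP.≤-trans s≤n (NP.n≤1+n n))))))
        (positive-wordWs m (suc i) (NP.≤-trans 2≤i (NP.n≤1+n i)) i+1+m≤1+s)
        where
        i+1+m≤1+s : suc i +ℕ m ≤ suc s
        i+1+m≤1+s = P.subst (_≤ suc s) (NP.+-suc i m) le
        i≤s : i ≤ s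
        i≤s = NP.≤-pred (NP.≤-trans (s≤s (NP.m≤m+n i m)) i+1+m≤1+s)

      positive-wordA^ : ∀ w → PositiveWord (wordA^ w)
      positive-wordA^ zero    = []
      positive-wordA^ (suc w) = ++⁺ (positive-wordWs (s ∸ 1) 2 NP.≤-refl (2+[m∸1]≤1+m 1≤s)) (positive-wordA^ w)

      cornerMinor-A^-pos : ∀ w κ (κ≤n : κ ≤ n) → 1 ≤ κ → κ ≤ w *ℕ (s ∸ 1) →
                           0# <F cornerMinor (Amat n s a ^M w) κ κ≤n
      cornerMinor-A^-pos w κ κ≤n 1≤κ κ≤w[s-1] =
        <-respʳ (sym (trans (cornerMinor≈minor _) (minor-cong (A^-evalWord w) (corner 0))))
          (minor-pos (wordA^ w) (corner 0) (positive-wordA^ w) Increasing-corner-zero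
                     (climb-wordA^ w 0 κ≤w[s-1]))
        where
        open Minors n κ κ≤n 1≤κ
        open Corners n κ κ≤n 1≤κ
        open Climbing s≤n 1≤s κ κ≤n 1≤κ

      -- With κ = n - 1 every row of the corner minor has to be lifted, and one factor A lifts
      -- at most s - 1 rows.
      cornerMinor-A^-zero : ∀ w (κ≤n : n ∸ 1 ≤ n) → w *ℕ (s ∸ 1) < n ∸ 1 →
                            cornerMinor (Amat n s a ^M w) (n ∸ 1) κ≤n ≈ 0#
      cornerMinor-A^-zero w κ≤n w[s-1]<n-1 =
        trans (cornerMinor≈minor _) (trans (minor-cong (A^-evalWord w) (corner 0))
          (minor-zero (wordA^ w) (corner 0) (positive-wordA^ w) Increasing-corner-zero too-short))
        where
        1≤n∸1 : 1 ≤ n ∸ 1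
        1≤n∸1 = NP.≤-<-trans z≤n w[s-1]<n-1
        open Minors n (n ∸ 1) κ≤n 1≤n∸1
        open Corners n (n ∸ 1) κ≤n 1≤n∸1
        too-short : ¬ Climbs (wordA^ w) (corner 0)
        too-short climbs = NP.<-irrefl P.refl (NP.≤-<-trans
          (NP.≤-trans (corner-frontier (NP.m∸[m∸n]≡n (NP.≤-trans 1≤n∸1 (NP.m∸n≤m n 1))) (wordA^ w) 0 climbs)
                      (frontier-wordA^ w 0))
          w[s-1]<n-1)

proposition9 : ∀ {c ℓ₁ ℓ₂} (F : OrderedField c ℓ₁ ℓ₂) (n s : ℕ) →
    2 ≤ n → 2 ≤ s → s ≤ n →
    (a : ℕ → ℕ → OrderedField.Carrier F) →
    (∀ i j → 2 ≤ i → i ≤ s → i ≤ j → j ≤ n → OrderedField._<F_ F (OrderedField.0# F) (a i j)) →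
    Mat.IsRl F (Mat.Amat F n s a) (ceilDiv (n ∸ 1) (s ∸ 1))
proposition9 F n (suc zero)     _   (s≤s ()) _   _ _
proposition9 F n (suc (suc s′)) 2≤n _        s≤n a apos =
    ceilDiv>0 (n ∸ 1) s′ 1≤n∸1
  , (λ κ 1≤κ κ<n → cornerMinor-A^-pos w₀ κ (NP.<⇒≤ κ<n) 1≤κ
                     (NP.≤-trans (NP.∸-monoˡ-≤ 1 κ<n) (m≤ceilDiv*n (n ∸ 1) s′)))
  , (λ w _ w<w₀ cornerPos →
       irrefl (sym (cornerMinor-A^-zero w (NP.<⇒≤ n∸1<n) (<ceilDiv⇒*n< (n ∸ 1) s′ w w<w₀)))
              (cornerPos (n ∸ 1) 1≤n∸1 n∸1<n))
  where
  open OrderedField F using (sym; isStrictTotalOrder)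
  open IsStrictTotalOrder isStrictTotalOrder using (irrefl)
  open Factorisation F n (suc (suc s′)) a
  open PowersOfA apos s≤n (s≤s z≤n)
  w₀ : ℕ
  w₀ = ceilDiv (n ∸ 1) (suc s′)
  1≤n∸1 : 1 ≤ n ∸ 1
  1≤n∸1 = NP.∸-monoˡ-≤ 1 2≤n
  n∸1<n : n ∸ 1 < n
  n∸1<n = NP.∸-monoʳ-< (s≤s z≤n) (NP.≤-trans (s≤s z≤n) 2≤n)
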